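{- Let $k\ge 4$ be an integer and let $\mathscr{C}_R(k)=\{\{1\},\{2\},\dots,\{k\},\{1,2\},\{2,3\},\dots,\{k-1,k\},\{1,k\}\}$, a code on $k$ neurons. Then $$\mathrm{CF}(\mathcal{J}_{\mathscr{C}_R(k)})=\Big\{\prod_{i=1}^{k}(1-x_i)\Big\}\cup\{x_ix_j\mid i,j\in[k],\ i>j,\ i-j\notin\{1,k-1\}\}.$$
   Context: A neural code on $n$ neurons is a collection of subsets of $[n]$. A pseudo-monomial in $\mathbb{F}_2[x_1,\dots,x_n]$ is a polynomial of the form $\prod_{i\in\sigma}x_i\prod_{j\in\tau}(1-x_j)$ with $\sigma,\tau\subseteq[n]$, $\sigma\cap\tau=\emptyset$. For an ideal $J$, a pseudo-monomial $f\in J$ is minimal if there is no pseudo-monomial $g\in J$ with $\deg g<\deg f$ and $f=hg$ for some polynomial $h$; $\mathrm{CF}(J)$ is the set of all minimal pseudo-monomials of $J$. For $v\subseteq[n]$ let $\rho_v=\prod_{i\in v}x_i\prod_{j\in[n]\setminus v}(1-x_j)$. The neural ideal is $\mathcal{J}_\mathcal{C}=\langle \rho_v\mid v\subseteq[n],\ v\notin\mathcal{C}\rangle\subseteq\mathbb{F}_2[x_1,\dots,x_n]$; here $n=k$. -}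

module Defs where

open import Data.Nat as ℕ using (ℕ; zero; suc; _<_; _≤_; _∸_; _⊔_)
open import Data.Bool using (Bool; true; false; not; if_then_else_)
open import Data.Fin using (Fin; toℕ)
open import Data.Fin.Subset using (Subset; ⁅_⁆; _∪_; ∁; _∈_; _∉_)
open import Data.Vec as Vec using (Vec; lookup; tabulate; replicate; zipWith)
open import Data.Vec.Properties using (≡-dec)
open import Data.List as List using (List; []; _∷_; _++_; map; foldr; concatMap; filter; allFin)
open import Data.Product using (Σ; ∃; ∃-syntax; _×_; _,_; proj₁; proj₂)
open import Data.Sum using (_⊎_)
open import Relation.Nullary using (¬_; does)
open import Relation.Binary.PropositionalEquality using (_≡_; _≢_)
open import Data.List.Relation.Unary.All using (All)

-- A monomial is an exponent vector; a polynomial is a formal F₂-sum of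
-- monomials, represented by a list (the coefficient of a monomial is the
-- parity of its number of occurrences).

Mon : ℕ → Set
Mon n = Vec ℕ n

Poly : ℕ → Set
Poly n = List (Mon n)

module _ {n : ℕ} where

  infix 4 _≈ₚ_
  infixl 6 _+ₚ_
  infixl 7 _*ₚ_

  coeff : Poly n → Mon n → Bool
  coeff p m = foldr (λ m′ b → if does (≡-dec ℕ._≟_ m′ m) then not b else b) false p

  _≈ₚ_ : Poly n → Poly n → Set
  p ≈ₚ q = ∀ m → coeff p m ≡ coeff q m

  0ₚ : Poly n
  0ₚ = []

  1ₚ : Poly n
  1ₚ = replicate n 0 ∷ []

  _+ₚ_ : Poly n → Poly n → Poly n
  p +ₚ q = p ++ q

  _*ₚ_ : Poly n → Poly n → Poly n
  p *ₚ q = concatMap (λ a → map (zipWith ℕ._+_ a) q) p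

  X : Fin n → Poly n
  X i = tabulate (λ j → if does (i Data.Fin.≟ j) then 1 else 0) ∷ []

  -- 1 - x_i  (= 1 + x_i over F₂)
  1-X : Fin n → Poly n
  1-X i = 1ₚ +ₚ X i

  prodₚ : List (Poly n) → Poly n
  prodₚ = foldr _*ₚ_ 1ₚ

  sumₚ : List (Poly n) → Poly n
  sumₚ = foldr _+ₚ_ 0ₚ

  totalDeg : Mon n → ℕ
  totalDeg = Vec.foldr _ ℕ._+_ 0

  deg : Poly n → ℕ
  deg p = foldr _⊔_ 0 (map totalDeg (filter (λ m → Data.Bool._≟_ (coeff p m) true) p))

  pm : Subset n → Subset n → Poly n
  pm σ τ = prodₚ (map (λ i → if lookup σ i then X i else (if lookup τ i then 1-X i else 1ₚ)) (allFin n))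

  Disjoint : Subset n → Subset n → Set
  Disjoint σ τ = ∀ i → ¬ (i ∈ σ × i ∈ τ)

  IsPseudoMonomial : Poly n → Set
  IsPseudoMonomial f = ∃[ σ ] ∃[ τ ] (Disjoint σ τ × f ≈ₚ pm σ τ)

  Ideal : Set₁
  Ideal = Poly n → Set

  ⟨_⟩ : (Poly n → Set) → Ideal
  ⟨ S ⟩ f = ∃[ ps ] (All (λ hg → S (proj₂ hg)) ps
                     × f ≈ₚ sumₚ (map (λ hg → proj₁ hg *ₚ proj₂ hg) ps))

  IsMinimalPM : Ideal → Poly n → Set
  IsMinimalPM J f = ¬ (∃[ g ] (IsPseudoMonomial g × J g × deg g < deg f
                               × ∃[ h ] (f ≈ₚ h *ₚ g)))

  CF : Ideal → Poly n → Set
  CF J f = IsPseudoMonomial f × J f × IsMinimalPM J f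

  Code : Set₁
  Code = Subset n → Set

  ρ : Subset n → Poly n
  ρ v = pm v (∁ v)

  neuralIdeal : Code → Ideal
  neuralIdeal C = ⟨ (λ g → ∃[ v ] (¬ C v × g ≡ ρ v)) ⟩

-- The code C_R(k) (neurons 1..k are Fin k indices 0..k-1):
-- singletons, consecutive pairs {i,i+1}, and {1,k}.
CR : (k : ℕ) → Code {k}
CR k v = (∃[ i ] v ≡ ⁅ i ⁆)
       ⊎ (∃[ i ] ∃[ j ] (toℕ j ≡ suc (toℕ i) × v ≡ ⁅ i ⁆ ∪ ⁅ j ⁆))
       ⊎ (∃[ i ] ∃[ j ] (toℕ i ≡ 0 × toℕ j ≡ k ∸ 1 × v ≡ ⁅ i ⁆ ∪ ⁅ j ⁆))

-- Everything is read off from values on {0,1}ⁿ.  Over F₂ a Möbius inversion recovers the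
-- coefficients of a multilinear polynomial from its values, so multilinear polynomials with the
-- same values are equal, and a nonzero inversion over S bounds the degree below by |S|.  Hence a
-- multilinear polynomial lies in J_C iff it vanishes on C (interpolate with the ρ_v), and
-- x_σ(1−x)_τ ∈ J_C iff no codeword c has σ ⊆ c ⊆ ∁τ.
--
-- For C = C_R(k) the codewords are the vertices and edges of the k-cycle.  If σ contains a
-- chord {i, j}, then x_i x_j ∈ J_C divides x_σ(1−x)_τ, so minimality forces the latter to be
-- x_i x_j.  Otherwise σ is a clique of the cycle, which for k ≥ 4 has no triangles, so σ is
-- empty or a codeword; a codeword σ is impossible, and σ = ∅ forces τ = [k] because the
-- singletons are codewords.  Conversely, evaluating a pseudo-monomial divisor in J_C at suitable
-- points shows it equals ∏(1 − x_i), resp. x_i x_j, so these are minimal.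

module Submission where

open import Defs
open import Data.Nat as ℕ using (ℕ; zero; suc; _<_; _≤_; _∸_; _⊔_; _+_; z≤n; s≤s)
import Data.Nat.Properties as ℕ
open import Data.Bool using (Bool; true; false; not; if_then_else_; _∧_; _xor_)
open import Data.Bool.Properties
  using (xor-assoc; xor-same; xor-identityʳ; ∧-distribˡ-xor; ∧-distribʳ-xor; ∧-identityʳ; ∧-zeroʳ;
         ∧-comm; ∧-idem; not-involutive; xor-∧-commutativeRing; ∧-commutativeMonoid)
open import Data.Fin as Fin using (Fin; toℕ)
open import Data.Fin.Properties using (all?; any?; suc-injective; toℕ-injective; toℕ<n)
open import Data.Fin.Subset using (Subset; _∈_; _∉_; _⊆_; ∁; ⁅_⁆; _∪_; _─_; _-_; ⊥; ⊤; ∣_∣)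
open import Data.Fin.Subset.Properties
  using (_∈?_; ⊆-antisym; ∪-comm; Empty-unique; ⊆⊤; ∉⊥; ∈⊤; x∈∁p⇒x∉p; x∉p⇒x∈∁p; x∈p∪q⁺; x∈p∪q⁻;
         x∈⁅x⁆; x∈⁅y⁆⇒x≡y; p─q⊆p; x∈p∧x≢y⇒x∈p-y; x∈p⇒∣p-x∣<∣p∣)
open import Data.Vec as Vec using (Vec; []; _∷_; lookup; tabulate; replicate; zipWith; here; there)
open import Data.Vec.Properties
  using (≡-dec; lookup-zipWith; lookup-replicate; lookup∘tabulate; ∷-injectiveˡ; ∷-injectiveʳ;
         []=⇒lookup; lookup⇒[]=)
open import Data.List as List using (List; []; _∷_; _++_; map; foldr; allFin)
import Data.List.Properties as ListP
open import Data.List.Relation.Unary.All as All using (All; []; _∷_)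
import Data.List.Relation.Unary.All.Properties as AllP
import Data.List.Relation.Unary.Any as Any
open import Data.List.Membership.Propositional using () renaming (_∈_ to _∈ₗ_)
open import Data.List.Membership.Propositional.Properties using (∈-map⁺; ∈-filter⁺)
open import Data.Product as Product using (∃-syntax; _×_; _,_; proj₁; proj₂)
open import Data.Sum as Sum using (_⊎_; inj₁; inj₂; [_,_]′)
open import Data.Empty using (⊥-elim) renaming (⊥ to ⊥ᵉ)
open import Function.Bundles using (_⇔_; mk⇔)
open import Relation.Nullary using (¬_; ¬?; Dec; does; yes; no; contradiction)
open import Relation.Nullary.Decidable using (dec-true; dec-false; _×-dec_)
open import Relation.Binary.Definitions using (tri<; tri≈; tri>)
open import Relation.Binary.PropositionalEquality
  using (_≡_; _≢_; refl; sym; trans; cong; cong₂; subst; subst₂; module ≡-Reasoning)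
open import Algebra.Bundles using (CommutativeRing; CommutativeMonoid)
import Algebra.Properties.CommutativeSemigroup as CommutativeSemigroupProperties

open CommutativeSemigroupProperties (CommutativeRing.+-commutativeSemigroup xor-∧-commutativeRing)
  using () renaming (interchange to xor-interchange)
open CommutativeSemigroupProperties (CommutativeMonoid.commutativeSemigroup ∧-commutativeMonoid)
  using () renaming (interchange to ∧-interchange)
open CommutativeSemigroupProperties ℕ.+-commutativeSemigroup
  using () renaming (interchange to +-interchange)

open ≡-Reasoning

xor≡false⇒≡ : ∀ {x y} → (x xor y) ≡ false → x ≡ y
xor≡false⇒≡ {true}  {true}  _ = refl
xor≡false⇒≡ {false} {false} _ = refl

∧-true⁻ : ∀ {x y} → (x ∧ y) ≡ true → x ≡ true × y ≡ true
∧-true⁻ {true} {true} _ = refl , refl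

≡true-ext : ∀ {x y} → (x ≡ true → y ≡ true) → (y ≡ true → x ≡ true) → x ≡ y
≡true-ext {true}  {y}     x⇒y _   = sym (x⇒y refl)
≡true-ext {false} {true}  _   y⇒x = y⇒x refl
≡true-ext {false} {false} _   _   = refl

x≡[x∧¬y]xor[x∧y] : ∀ x y → x ≡ ((x ∧ not y) xor (x ∧ y))
x≡[x∧¬y]xor[x∧y] true  true  = refl
x≡[x∧¬y]xor[x∧y] true  false = refl
x≡[x∧¬y]xor[x∧y] false y     = refl

x∈p─q⇒x∉q : ∀ {n} (p q : Subset n) {x} → x ∈ p ─ q → x ∉ q
x∈p─q⇒x∉q (_ ∷ p) (_ ∷ q) (there x∈p─q) (there x∈q) = x∈p─q⇒x∉q p q x∈p─q x∈q
x∈p─q⇒x∉q (_ ∷ p) (_ ∷ q) ()            here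

module _ {n : ℕ} where

  pair-member : ∀ {i j x : Fin n} → x ∈ ⁅ i ⁆ ∪ ⁅ j ⁆ → x ≡ i ⊎ x ≡ j
  pair-member {i} {j} x∈pair = Sum.map (x∈⁅y⁆⇒x≡y i) (x∈⁅y⁆⇒x≡y j) (x∈p∪q⁻ ⁅ i ⁆ ⁅ j ⁆ x∈pair)

  pair⊆ : ∀ {i j : Fin n} {c} → i ∈ c → j ∈ c → ⁅ i ⁆ ∪ ⁅ j ⁆ ⊆ c
  pair⊆ {i} {j} i∈c j∈c x∈pair with x∈p∪q⁻ ⁅ i ⁆ ⁅ j ⁆ x∈pair
  ... | inj₁ x∈⁅i⁆ rewrite x∈⁅y⁆⇒x≡y i x∈⁅i⁆ = i∈c
  ... | inj₂ x∈⁅j⁆ rewrite x∈⁅y⁆⇒x≡y j x∈⁅j⁆ = j∈c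

  i∈pair : ∀ (i j : Fin n) → i ∈ ⁅ i ⁆ ∪ ⁅ j ⁆
  i∈pair i j = x∈p∪q⁺ (inj₁ (x∈⁅x⁆ i))

  j∈pair : ∀ (i j : Fin n) → j ∈ ⁅ i ⁆ ∪ ⁅ j ⁆
  j∈pair i j = x∈p∪q⁺ (inj₂ (x∈⁅x⁆ j))

  Disjoint-⊥ : ∀ (σ : Subset n) → Disjoint σ ⊥
  Disjoint-⊥ σ l (_ , l∈⊥) = ∉⊥ l∈⊥

  ⊥-Disjoint : ∀ (τ : Subset n) → Disjoint ⊥ τ
  ⊥-Disjoint τ l (l∈⊥ , _) = ∉⊥ l∈⊥

  3≤∣S∣ : ∀ {S : Subset n} {a b c} → a ∈ S → b ∈ S → c ∈ S → a ≢ b → a ≢ c → b ≢ c → 3 ≤ ∣ S ∣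
  3≤∣S∣ {S} {a} {b} {c} a∈S b∈S c∈S a≢b a≢c b≢c =
    ℕ.≤-trans (s≤s (s≤s (s≤s z≤n)))
      (ℕ.≤-trans (s≤s (s≤s (x∈p⇒∣p-x∣<∣p∣ c∈S-a-b)))
        (ℕ.≤-trans (s≤s (x∈p⇒∣p-x∣<∣p∣ b∈S-a)) (x∈p⇒∣p-x∣<∣p∣ a∈S)))
    where
    b∈S-a = x∈p∧x≢y⇒x∈p-y b∈S (λ b≡a → a≢b (sym b≡a))
    c∈S-a-b = x∈p∧x≢y⇒x∈p-y (x∈p∧x≢y⇒x∈p-y c∈S (λ c≡a → a≢c (sym c≡a))) (λ c≡b → b≢c (sym c≡b))

parity : {A : Set} → (A → Bool) → List A → Bool
parity F = foldr (λ a b → F a xor b) false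

module _ {A : Set} where

  parity-++ : ∀ F (p q : List A) → parity F (p ++ q) ≡ (parity F p xor parity F q)
  parity-++ F []      q = refl
  parity-++ F (a ∷ p) q = trans (cong (F a xor_) (parity-++ F p q)) (sym (xor-assoc (F a) _ _))

  parity-map : ∀ {B : Set} F (g : B → A) p → parity F (map g p) ≡ parity (λ b → F (g b)) p
  parity-map F g []      = refl
  parity-map F g (b ∷ p) = cong (F (g b) xor_) (parity-map F g p)

  parity-congᴬ : ∀ {F G} {p : List A} → All (λ a → F a ≡ G a) p → parity F p ≡ parity G p
  parity-congᴬ []       = refl
  parity-congᴬ (e ∷ es) = cong₂ _xor_ e (parity-congᴬ es)

  parity-cong : ∀ {F G} → (∀ a → F a ≡ G a) → ∀ p → parity F p ≡ parity G p
  parity-cong e p = parity-congᴬ (All.universal e p)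

  parity-false : ∀ (p : List A) → parity (λ _ → false) p ≡ false
  parity-false []      = refl
  parity-false (_ ∷ p) = parity-false p

  parity-∧ˡ : ∀ b F (p : List A) → parity (λ a → b ∧ F a) p ≡ (b ∧ parity F p)
  parity-∧ˡ b F []      = sym (∧-zeroʳ b)
  parity-∧ˡ b F (a ∷ p) = trans (cong ((b ∧ F a) xor_) (parity-∧ˡ b F p)) (sym (∧-distribˡ-xor b (F a) _))

  parity-xor : ∀ F G (p : List A) → parity (λ a → F a xor G a) p ≡ (parity F p xor parity G p)
  parity-xor F G []      = refl
  parity-xor F G (a ∷ p) = trans (cong ((F a xor G a) xor_) (parity-xor F G p)) (xor-interchange (F a) (G a) _ _)

module _ {n : ℕ} where

  infix 4 _≡ᵇ_

  _≡ᵇ_ : Mon n → Mon n → Bool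
  a ≡ᵇ b = does (≡-dec ℕ._≟_ a b)

  ≈-sym : ∀ {p q : Poly n} → p ≈ₚ q → q ≈ₚ p
  ≈-sym p≈q m = sym (p≈q m)

  ≈-trans : ∀ {p q r : Poly n} → p ≈ₚ q → q ≈ₚ r → p ≈ₚ r
  ≈-trans p≈q q≈r m = trans (p≈q m) (q≈r m)

  coeff-∷ : ∀ a (p : Poly n) b → coeff (a ∷ p) b ≡ ((a ≡ᵇ b) xor coeff p b)
  coeff-∷ a p b with a ≡ᵇ b
  ... | true  = refl
  ... | false = refl

  coeff-∷-self : ∀ a (p : Poly n) → coeff (a ∷ p) a ≡ not (coeff p a)
  coeff-∷-self a p = trans (coeff-∷ a p a) (cong (_xor coeff p a) (dec-true (≡-dec ℕ._≟_ a a) refl))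

  coeff-∷-≢ : ∀ {a b} (p : Poly n) → a ≢ b → coeff (a ∷ p) b ≡ coeff p b
  coeff-∷-≢ {a} {b} p a≢b = trans (coeff-∷ a p b) (cong (_xor coeff p b) (dec-false (≡-dec ℕ._≟_ a b) a≢b))

  coeff≡parity : ∀ (p : Poly n) a → coeff p a ≡ parity (_≡ᵇ a) p
  coeff≡parity []      a = refl
  coeff≡parity (b ∷ p) a = trans (coeff-∷ b p a) (cong ((b ≡ᵇ a) xor_) (coeff≡parity p a))

  coeff-++ : ∀ (p q : Poly n) a → coeff (p ++ q) a ≡ (coeff p a xor coeff q a)
  coeff-++ p q a = begin
    coeff (p ++ q) a                              ≡⟨ coeff≡parity (p ++ q) a ⟩
    parity (_≡ᵇ a) (p ++ q)                       ≡⟨ parity-++ (_≡ᵇ a) p q ⟩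
    parity (_≡ᵇ a) p xor parity (_≡ᵇ a) q         ≡⟨ sym (cong₂ _xor_ (coeff≡parity p a) (coeff≡parity q a)) ⟩
    coeff p a xor coeff q a                       ∎

  coeff-true⇒∈ : ∀ (p : Poly n) a → coeff p a ≡ true → a ∈ₗ p
  coeff-true⇒∈ (b ∷ p) a e with ≡-dec ℕ._≟_ b a
  ... | yes b≡a = Any.here (sym b≡a)
  ... | no  _   = Any.there (coeff-true⇒∈ p a e)

  parity-split : ∀ F (p : Poly n) a →
    parity F p ≡ (parity (λ b → F b ∧ not (a ≡ᵇ b)) p xor (F a ∧ coeff p a))
  parity-split F p a = begin
    parity F p
      ≡⟨ parity-cong (λ b → x≡[x∧¬y]xor[x∧y] (F b) (a ≡ᵇ b)) p ⟩
    parity (λ b → F′ b xor (F b ∧ (a ≡ᵇ b))) p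
      ≡⟨ parity-xor F′ (λ b → F b ∧ (a ≡ᵇ b)) p ⟩
    parity F′ p xor parity (λ b → F b ∧ (a ≡ᵇ b)) p
      ≡⟨ cong (parity F′ p xor_) (parity-cong at-a p) ⟩
    parity F′ p xor parity (λ b → F a ∧ (b ≡ᵇ a)) p
      ≡⟨ cong (parity F′ p xor_) (parity-∧ˡ (F a) (_≡ᵇ a) p) ⟩
    parity F′ p xor (F a ∧ parity (_≡ᵇ a) p)
      ≡⟨ cong (λ c → parity F′ p xor (F a ∧ c)) (sym (coeff≡parity p a)) ⟩
    parity F′ p xor (F a ∧ coeff p a)
      ∎
    where
    F′ : Mon n → Bool
    F′ b = F b ∧ not (a ≡ᵇ b)
    at-a : ∀ b → (F b ∧ (a ≡ᵇ b)) ≡ (F a ∧ (b ≡ᵇ a))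
    at-a b with ≡-dec ℕ._≟_ a b
    ... | yes refl = cong (F a ∧_) (sym (dec-true (≡-dec ℕ._≟_ a a) refl))
    ... | no  a≢b  = trans (∧-zeroʳ (F b))
                       (sym (trans (cong (F a ∧_) (dec-false (≡-dec ℕ._≟_ b a) (λ b≡a → a≢b (sym b≡a)))) (∧-zeroʳ (F a))))

  -- Makes parity sums, and hence evaluation, well defined on ≈ₚ-classes.
  parity-vanishes : ∀ F (p : Poly n) → (∀ a → coeff p a ≡ true → F a ≡ false) → parity F p ≡ false
  parity-vanishes F []      _ = refl
  parity-vanishes F (a ∷ p) h with coeff p a in p∋a
  ... | false = begin
    F a xor parity F p  ≡⟨ cong₂ _xor_ (h a a-odd) (parity-vanishes F p rest) ⟩
    false               ∎
    where
    a-odd : coeff (a ∷ p) a ≡ true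
    a-odd = trans (coeff-∷-self a p) (cong not p∋a)
    rest : ∀ b → coeff p b ≡ true → F b ≡ false
    rest b e with ≡-dec ℕ._≟_ a b
    ... | yes refl = contradiction (trans (sym p∋a) e) λ ()
    ... | no  a≢b  = h b (trans (coeff-∷-≢ p a≢b) e)
  ... | true = begin
    F a xor parity F p                                   ≡⟨ cong (F a xor_) (parity-split F p a) ⟩
    F a xor (parity F′ p xor (F a ∧ coeff p a))
                               ≡⟨ cong (λ c → F a xor (c xor (F a ∧ coeff p a))) (parity-vanishes F′ p rest) ⟩
    F a xor (false xor (F a ∧ coeff p a))                ≡⟨ cong (λ c → F a xor (F a ∧ c)) p∋a ⟩
    F a xor (F a ∧ true)                                 ≡⟨ cong (F a xor_) (∧-identityʳ (F a)) ⟩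
    F a xor F a                                          ≡⟨ xor-same (F a) ⟩
    false                                                ∎
    where
    F′ : Mon n → Bool
    F′ b = F b ∧ not (a ≡ᵇ b)
    rest : ∀ b → coeff p b ≡ true → F′ b ≡ false
    rest b e with ≡-dec ℕ._≟_ a b
    ... | yes refl = ∧-zeroʳ (F a)
    ... | no  a≢b  = cong (_∧ true) (h b (trans (coeff-∷-≢ p a≢b) e))

  parity-resp-≈ : ∀ F {p q : Poly n} → p ≈ₚ q → parity F p ≡ parity F q
  parity-resp-≈ F {p} {q} p≈q = xor≡false⇒≡ (trans (sym (parity-++ F p q)) (parity-vanishes F (p ++ q) cancels))
    where
    cancels : ∀ a → coeff (p ++ q) a ≡ true → F a ≡ false
    cancels a e = contradiction (trans (sym e) (trans (coeff-++ p q a) (trans (cong (_xor coeff q a) (p≈q a)) (xor-same (coeff q a)))))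
                                λ ()

  parity-true⇒coeff : ∀ F (p : Poly n) → parity F p ≡ true → ∃[ a ] (coeff p a ≡ true × F a ≡ true)
  parity-true⇒coeff F p odd with Any.any? (λ a → (coeff p a Data.Bool.≟ true) ×-dec (F a Data.Bool.≟ true)) p
  ... | yes found = Any.satisfied found
  ... | no  none  = contradiction (trans (sym odd) (parity-vanishes F p vanish)) λ ()
    where
    vanish : ∀ a → coeff p a ≡ true → F a ≡ false
    vanish a e with F a in Fa
    ... | false = refl
    ... | true  = contradiction (Any.map (λ { refl → e , Fa }) (coeff-true⇒∈ p a e)) none

-- Evaluation at points of {0,1}ⁿ

_^ᵇ_ : Bool → ℕ → Bool
x ^ᵇ zero  = true
x ^ᵇ suc _ = x

^ᵇ-+ : ∀ x d e → x ^ᵇ (d + e) ≡ (x ^ᵇ d ∧ x ^ᵇ e)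
^ᵇ-+ x zero    e       = refl
^ᵇ-+ x (suc d) zero    = sym (∧-identityʳ x)
^ᵇ-+ x (suc d) (suc e) = sym (∧-idem x)

evalMon : ∀ {n} → Vec Bool n → Mon n → Bool
evalMon []      []      = true
evalMon (x ∷ c) (d ∷ m) = x ^ᵇ d ∧ evalMon c m

evalMon-+ : ∀ {n} (c : Vec Bool n) a b → evalMon c (zipWith _+_ a b) ≡ (evalMon c a ∧ evalMon c b)
evalMon-+ []      []      []      = refl
evalMon-+ (x ∷ c) (d ∷ a) (e ∷ b) = begin
  x ^ᵇ (d + e) ∧ evalMon c (zipWith _+_ a b)           ≡⟨ cong₂ _∧_ (^ᵇ-+ x d e) (evalMon-+ c a b) ⟩
  (x ^ᵇ d ∧ x ^ᵇ e) ∧ (evalMon c a ∧ evalMon c b)      ≡⟨ ∧-interchange (x ^ᵇ d) (x ^ᵇ e) _ _ ⟩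
  (x ^ᵇ d ∧ evalMon c a) ∧ (x ^ᵇ e ∧ evalMon c b)      ∎

evalMon-zeros : ∀ {n} (c : Vec Bool n) m → (∀ j → lookup m j ≡ 0) → evalMon c m ≡ true
evalMon-zeros []      []      m≡0 = refl
evalMon-zeros (x ∷ c) (d ∷ m) m≡0 rewrite m≡0 Fin.zero = evalMon-zeros c m (λ j → m≡0 (Fin.suc j))

evalMon-var : ∀ {n} (c : Vec Bool n) i → evalMon c (tabulate (λ j → if does (i Fin.≟ j) then 1 else 0)) ≡ lookup c i
evalMon-var (x ∷ c) Fin.zero    = trans (cong (x ∧_) (evalMon-zeros c _ (lookup∘tabulate _))) (∧-identityʳ x)
evalMon-var (x ∷ c) (Fin.suc i) = evalMon-var c i

allᶠ : ∀ {m} → (Fin m → Bool) → Bool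
allᶠ {zero}  g = true
allᶠ {suc m} g = g Fin.zero ∧ allᶠ (λ r → g (Fin.suc r))

allᶠ-true⁻ : ∀ {m} (g : Fin m → Bool) → allᶠ g ≡ true → ∀ r → g r ≡ true
allᶠ-true⁻ {suc m} g all-g r with g Fin.zero in g0
allᶠ-true⁻ {suc m} g all-g Fin.zero    | true = g0
allᶠ-true⁻ {suc m} g all-g (Fin.suc r) | true = allᶠ-true⁻ (λ r → g (Fin.suc r)) all-g r

allᶠ-true⁺ : ∀ {m} (g : Fin m → Bool) → (∀ r → g r ≡ true) → allᶠ g ≡ true
allᶠ-true⁺ {zero}  g g≡true = refl
allᶠ-true⁺ {suc m} g g≡true rewrite g≡true Fin.zero = allᶠ-true⁺ (λ r → g (Fin.suc r)) (λ r → g≡true (Fin.suc r))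

module _ {n : ℕ} where

  eval : Vec Bool n → Poly n → Bool
  eval c = parity (evalMon c)

  eval-++ : ∀ c (p q : Poly n) → eval c (p ++ q) ≡ (eval c p xor eval c q)
  eval-++ c = parity-++ (evalMon c)

  eval-* : ∀ c (p q : Poly n) → eval c (p *ₚ q) ≡ (eval c p ∧ eval c q)
  eval-* c []      q = refl
  eval-* c (a ∷ p) q = begin
    eval c (map (zipWith _+_ a) q ++ p *ₚ q)                   ≡⟨ eval-++ c (map (zipWith _+_ a) q) (p *ₚ q) ⟩
    eval c (map (zipWith _+_ a) q) xor eval c (p *ₚ q)         ≡⟨ cong₂ _xor_ shifted (eval-* c p q) ⟩
    (evalMon c a ∧ eval c q) xor (eval c p ∧ eval c q)          ≡⟨ sym (∧-distribʳ-xor (eval c q) (evalMon c a) (eval c p)) ⟩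
    (evalMon c a xor eval c p) ∧ eval c q                      ∎
    where
    shifted : eval c (map (zipWith _+_ a) q) ≡ (evalMon c a ∧ eval c q)
    shifted = begin
      eval c (map (zipWith _+_ a) q)                  ≡⟨ parity-map (evalMon c) (zipWith _+_ a) q ⟩
      parity (λ b → evalMon c (zipWith _+_ a b)) q    ≡⟨ parity-cong (evalMon-+ c a) q ⟩
      parity (λ b → evalMon c a ∧ evalMon c b) q      ≡⟨ parity-∧ˡ (evalMon c a) (evalMon c) q ⟩
      evalMon c a ∧ eval c q                          ∎

  eval-1ₚ : ∀ c → eval c 1ₚ ≡ true
  eval-1ₚ c = trans (xor-identityʳ _) (evalMon-zeros c (replicate n 0) (λ j → lookup-replicate j 0))

  eval-X : ∀ c (i : Fin n) → eval c (X i) ≡ lookup c i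
  eval-X c i = trans (xor-identityʳ _) (evalMon-var c i)

  eval-1-X : ∀ c (i : Fin n) → eval c (1-X i) ≡ not (lookup c i)
  eval-1-X c i = begin
    eval c (1ₚ ++ X i)             ≡⟨ eval-++ c 1ₚ (X i) ⟩
    eval c 1ₚ xor eval c (X i)     ≡⟨ cong₂ _xor_ (eval-1ₚ c) (eval-X c i) ⟩
    not (lookup c i)               ∎

  eval-X*X : ∀ c (i j : Fin n) → eval c (X i *ₚ X j) ≡ (lookup c i ∧ lookup c j)
  eval-X*X c i j = trans (eval-* c (X i) (X j)) (cong₂ _∧_ (eval-X c i) (eval-X c j))

  eval-sum : ∀ c (ps : List (Poly n)) → eval c (sumₚ ps) ≡ parity (eval c) ps
  eval-sum c []       = refl
  eval-sum c (p ∷ ps) = trans (eval-++ c p (sumₚ ps)) (cong (eval c p xor_) (eval-sum c ps))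

  eval-prod-tabulate : ∀ c (G : Fin n → Poly n) {m} (f : Fin m → Fin n) →
    eval c (prodₚ (map G (List.tabulate f))) ≡ allᶠ (λ r → eval c (G (f r)))
  eval-prod-tabulate c G {zero}  f = eval-1ₚ c
  eval-prod-tabulate c G {suc m} f =
    trans (eval-* c (G (f Fin.zero)) _) (cong (eval c (G (f Fin.zero)) ∧_) (eval-prod-tabulate c G (λ r → f (Fin.suc r))))

  eval-resp-≈ : ∀ c {p q : Poly n} → p ≈ₚ q → eval c p ≡ eval c q
  eval-resp-≈ c {p} {q} = parity-resp-≈ (evalMon c) {p} {q}

literal : Bool → Bool → Bool → Bool
literal s t x = if s then x else (if t then not x else true)

module _ {n : ℕ} where

  ∈⇒lookup : ∀ {l : Fin n} {p} → l ∈ p → lookup p l ≡ true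
  ∈⇒lookup = []=⇒lookup

  lookup⇒∈ : ∀ {l : Fin n} {p} → lookup p l ≡ true → l ∈ p
  lookup⇒∈ {l} {p} = lookup⇒[]= l p

  ∉⇒lookup : ∀ {l : Fin n} {p} → l ∉ p → lookup p l ≡ false
  ∉⇒lookup {l} {p} l∉p with lookup p l in e
  ... | true  = contradiction (lookup⇒∈ e) l∉p
  ... | false = refl

  lookup⇒∉ : ∀ {l : Fin n} {p} → lookup p l ≡ false → l ∉ p
  lookup⇒∉ e l∈p = contradiction (trans (sym e) (∈⇒lookup l∈p)) λ ()

  Disjoint-tail : ∀ {s t} {σ τ : Subset n} → Disjoint (s ∷ σ) (t ∷ τ) → Disjoint σ τ
  Disjoint-tail σ∩τ=∅ l (l∈σ , l∈τ) = σ∩τ=∅ (Fin.suc l) (there l∈σ , there l∈τ)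

  factor : Subset n → Subset n → Fin n → Poly n
  factor σ τ i = if lookup σ i then X i else (if lookup τ i then 1-X i else 1ₚ)

  -- fits σ τ c  says  σ ⊆ c ⊆ ∁ τ,  i.e. that  pm σ τ  does not vanish at c.
  fits : Subset n → Subset n → Vec Bool n → Bool
  fits σ τ c = allᶠ (λ l → literal (lookup σ l) (lookup τ l) (lookup c l))

  eval-factor : ∀ c σ τ l → eval c (factor σ τ l) ≡ literal (lookup σ l) (lookup τ l) (lookup c l)
  eval-factor c σ τ l with lookup σ l | lookup τ l
  ... | true  | _     = eval-X c l
  ... | false | true  = eval-1-X c l
  ... | false | false = eval-1ₚ c

  eval-pm : ∀ c σ τ → eval c (pm σ τ) ≡ fits σ τ c
  eval-pm c σ τ = trans (eval-prod-tabulate c (factor σ τ) (λ l → l)) (allᶠ-cong (eval-factor c σ τ))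
    where
    allᶠ-cong : ∀ {m} {g h : Fin m → Bool} → (∀ r → g r ≡ h r) → allᶠ g ≡ allᶠ h
    allᶠ-cong {zero}  e = refl
    allᶠ-cong {suc m} e = cong₂ _∧_ (e Fin.zero) (allᶠ-cong (λ r → e (Fin.suc r)))

  fits⁺ : ∀ {σ τ c} → σ ⊆ c → τ ⊆ ∁ c → fits σ τ c ≡ true
  fits⁺ {σ} {τ} {c} σ⊆c τ⊆∁c = allᶠ-true⁺ _ literal-true
    where
    literal-true : ∀ l → literal (lookup σ l) (lookup τ l) (lookup c l) ≡ true
    literal-true l with lookup σ l in σl | lookup τ l in τl
    ... | true  | _     = ∈⇒lookup (σ⊆c (lookup⇒∈ σl))
    ... | false | true  = cong not (∉⇒lookup (x∈∁p⇒x∉p (τ⊆∁c (lookup⇒∈ τl))))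
    ... | false | false = refl

  fits⁻ : ∀ {σ τ c} → Disjoint σ τ → fits σ τ c ≡ true → σ ⊆ c × τ ⊆ ∁ c
  fits⁻ {σ} {τ} {c} σ∩τ=∅ fit = σ⊆c , τ⊆∁c
    where
    literal-true : ∀ l → literal (lookup σ l) (lookup τ l) (lookup c l) ≡ true
    literal-true = allᶠ-true⁻ _ fit
    σ⊆c : σ ⊆ c
    σ⊆c {l} l∈σ = lookup⇒∈ (subst (λ s → literal s (lookup τ l) (lookup c l) ≡ true) (∈⇒lookup l∈σ) (literal-true l))
    τ⊆∁c : τ ⊆ ∁ c
    τ⊆∁c {l} l∈τ = x∉p⇒x∈∁p (lookup⇒∉ (trans (sym (not-involutive (lookup c l))) (cong not ¬cₗ)))
      where
      ¬cₗ : not (lookup c l) ≡ true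
      ¬cₗ = subst₂ (λ s t → literal s t (lookup c l) ≡ true)
                   (∉⇒lookup (λ l∈σ → σ∩τ=∅ l (l∈σ , l∈τ))) (∈⇒lookup l∈τ) (literal-true l)

-- Möbius inversion and multilinear polynomials

infix 4 _==_

_==_ : ∀ {n} → Vec Bool n → Vec Bool n → Bool
[]      == []      = true
(x ∷ u) == (y ∷ v) = not (x xor y) ∧ (u == v)

==-refl : ∀ {n} (u : Vec Bool n) → (u == u) ≡ true
==-refl []      = refl
==-refl (x ∷ u) rewrite xor-same x = ==-refl u

==⇒≡ : ∀ {n} (u v : Vec Bool n) → (u == v) ≡ true → u ≡ v
==⇒≡ []          []          _ = refl
==⇒≡ (true ∷ u)  (true ∷ v)  e = cong (true ∷_) (==⇒≡ u v e)
==⇒≡ (false ∷ u) (false ∷ v) e = cong (false ∷_) (==⇒≡ u v e)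

positive : ℕ → Bool
positive zero    = false
positive (suc _) = true

support : ∀ {n} → Mon n → Subset n
support = Vec.map positive

Squarefree : ∀ {n} → Mon n → Set
Squarefree m = ∀ x → lookup m x ≤ 1

Multilinear : ∀ {n} → Poly n → Set
Multilinear = All Squarefree

support-injective : ∀ {n} (a b : Mon n) → Squarefree a → Squarefree b → support a ≡ support b → a ≡ b
support-injective []      []      _     _     _ = refl
support-injective (d ∷ a) (e ∷ b) sq-da sq-eb eq =
  cong₂ _∷_ (heads d e (sq-da Fin.zero) (sq-eb Fin.zero) (∷-injectiveˡ eq))
            (support-injective a b (λ x → sq-da (Fin.suc x)) (λ x → sq-eb (Fin.suc x)) (∷-injectiveʳ eq))
  where
  heads : ∀ d e → d ≤ 1 → e ≤ 1 → positive d ≡ positive e → d ≡ e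
  heads zero          zero          _         _         _ = refl
  heads (suc zero)    (suc zero)    _         _         _ = refl
  heads (suc (suc _)) _             (s≤s ()) _         _
  heads _             (suc (suc _)) _         (s≤s ()) _

-- mobius S f  is the sum of  f c  over the subsets c ⊆ S.  On a multilinear p it inverts
-- evaluation: the coefficient of the monomial  ∏_{i ∈ S} x_i  is  mobius S (λ c → eval c p).
mobius : ∀ {n} → Subset n → (Vec Bool n → Bool) → Bool
mobius []          f = f []
mobius (true ∷ S)  f = mobius S (λ c → f (true ∷ c)) xor mobius S (λ c → f (false ∷ c))
mobius (false ∷ S) f = mobius S (λ c → f (false ∷ c))

mobius-cong : ∀ {n} (S : Subset n) {f g} → (∀ c → f c ≡ g c) → mobius S f ≡ mobius S g
mobius-cong []          e = e []
mobius-cong (true ∷ S)  e = cong₂ _xor_ (mobius-cong S (λ c → e (true ∷ c))) (mobius-cong S (λ c → e (false ∷ c)))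
mobius-cong (false ∷ S) e = mobius-cong S (λ c → e (false ∷ c))

mobius-false : ∀ {n} (S : Subset n) → mobius S (λ _ → false) ≡ false
mobius-false []          = refl
mobius-false (true ∷ S)  = cong₂ _xor_ (mobius-false S) (mobius-false S)
mobius-false (false ∷ S) = mobius-false S

mobius-xor : ∀ {n} (S : Subset n) f g → mobius S (λ c → f c xor g c) ≡ (mobius S f xor mobius S g)
mobius-xor []          f g = refl
mobius-xor (true ∷ S)  f g =
  trans (cong₂ _xor_ (mobius-xor S (λ c → f (true ∷ c)) (λ c → g (true ∷ c)))
                     (mobius-xor S (λ c → f (false ∷ c)) (λ c → g (false ∷ c))))
        (xor-interchange (mobius S (λ c → f (true ∷ c))) (mobius S (λ c → g (true ∷ c)))
                         (mobius S (λ c → f (false ∷ c))) (mobius S (λ c → g (false ∷ c))))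
mobius-xor (false ∷ S) f g = mobius-xor S (λ c → f (false ∷ c)) (λ c → g (false ∷ c))

mobius-parity : ∀ {n} (S : Subset n) (h : Vec Bool n → Mon n → Bool) p →
  mobius S (λ c → parity (h c) p) ≡ parity (λ b → mobius S (λ c → h c b)) p
mobius-parity S h []      = mobius-false S
mobius-parity S h (b ∷ p) =
  trans (mobius-xor S (λ c → h c b) (λ c → parity (h c) p)) (cong (mobius S (λ c → h c b) xor_) (mobius-parity S h p))

mobius-evalMon : ∀ {n} (S : Subset n) b → mobius S (λ c → evalMon c b) ≡ (support b == S)
mobius-evalMon []          []          = refl
mobius-evalMon (true ∷ S)  (zero ∷ b)  = xor-same (mobius S (λ c → evalMon c b))
mobius-evalMon (true ∷ S)  (suc _ ∷ b) =
  trans (cong (mobius S (λ c → evalMon c b) xor_) (mobius-false S)) (trans (xor-identityʳ _) (mobius-evalMon S b))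
mobius-evalMon (false ∷ S) (zero ∷ b)  = mobius-evalMon S b
mobius-evalMon (false ∷ S) (suc _ ∷ b) = mobius-false S

mobius-eval : ∀ {n} (S : Subset n) p → mobius S (λ c → eval c p) ≡ parity (λ b → support b == S) p
mobius-eval S p = trans (mobius-parity S evalMon p) (parity-cong (mobius-evalMon S) p)

mobius-fits : ∀ {n} (σ τ : Subset n) → Disjoint σ τ → mobius (σ ∪ τ) (fits σ τ) ≡ true
mobius-fits []          []          _     = refl
mobius-fits (true ∷ σ)  (true ∷ τ)  σ∩τ=∅ = contradiction (here , here) (σ∩τ=∅ Fin.zero)
mobius-fits (true ∷ σ)  (false ∷ τ) σ∩τ=∅ =
  cong₂ _xor_ (mobius-fits σ τ (Disjoint-tail σ∩τ=∅)) (mobius-false (σ ∪ τ))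
mobius-fits (false ∷ σ) (true ∷ τ)  σ∩τ=∅ =
  cong₂ _xor_ (mobius-false (σ ∪ τ)) (mobius-fits σ τ (Disjoint-tail σ∩τ=∅))
mobius-fits (false ∷ σ) (false ∷ τ) σ∩τ=∅ = mobius-fits σ τ (Disjoint-tail σ∩τ=∅)

module _ {n : ℕ} where

  ≡ᵇ-support : ∀ (m a : Mon n) → Squarefree m → Squarefree a → (m ≡ᵇ a) ≡ (support m == support a)
  ≡ᵇ-support m a sq-m sq-a with ≡-dec ℕ._≟_ m a | support m == support a in same-support
  ... | yes refl | _     = trans (sym (==-refl (support m))) same-support
  ... | no  _    | false = refl
  ... | no  m≢a  | true  = contradiction (support-injective m a sq-m sq-a (==⇒≡ _ _ same-support)) m≢a

  coeff≡mobius : ∀ (p : Poly n) a → Multilinear p → Squarefree a → coeff p a ≡ mobius (support a) (λ c → eval c p)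
  coeff≡mobius p a ml-p sq-a = begin
    coeff p a                                 ≡⟨ coeff≡parity p a ⟩
    parity (_≡ᵇ a) p                          ≡⟨ parity-congᴬ (All.map (λ {m} sq-m → ≡ᵇ-support m a sq-m sq-a) ml-p) ⟩
    parity (λ m → support m == support a) p   ≡⟨ sym (mobius-eval (support a) p) ⟩
    mobius (support a) (λ c → eval c p)       ∎

  coeff-nonsquarefree : ∀ (p : Poly n) a → Multilinear p → ¬ Squarefree a → coeff p a ≡ false
  coeff-nonsquarefree p a ml-p ¬sq-a with coeff p a in p∋a
  ... | false = refl
  ... | true  = contradiction (All.lookup ml-p (coeff-true⇒∈ p a p∋a)) ¬sq-a

  multilinear-ext : ∀ {p q : Poly n} → Multilinear p → Multilinear q → (∀ c → eval c p ≡ eval c q) → p ≈ₚ q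
  multilinear-ext {p} {q} ml-p ml-q same-values a with all? (λ x → lookup a x ℕ.≤? 1)
  ... | yes sq-a = begin
    coeff p a                               ≡⟨ coeff≡mobius p a ml-p sq-a ⟩
    mobius (support a) (λ c → eval c p)     ≡⟨ mobius-cong (support a) same-values ⟩
    mobius (support a) (λ c → eval c q)     ≡⟨ sym (coeff≡mobius q a ml-q sq-a) ⟩
    coeff q a                               ∎
  ... | no ¬sq-a = trans (coeff-nonsquarefree p a ml-p ¬sq-a) (sym (coeff-nonsquarefree q a ml-q ¬sq-a))

foldr⊔-lub : ∀ {d} xs → All (_≤ d) xs → foldr _⊔_ 0 xs ≤ d
foldr⊔-lub []       []         = z≤n
foldr⊔-lub (x ∷ xs) (x≤d ∷ h) = ℕ.⊔-lub x≤d (foldr⊔-lub xs h)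

∈⇒≤foldr⊔ : ∀ {x} xs → x ∈ₗ xs → x ≤ foldr _⊔_ 0 xs
∈⇒≤foldr⊔ (y ∷ xs) (Any.here refl)  = ℕ.m≤m⊔n y (foldr _⊔_ 0 xs)
∈⇒≤foldr⊔ (y ∷ xs) (Any.there x∈xs) = ℕ.m≤n⇒m≤o⊔n y (∈⇒≤foldr⊔ xs x∈xs)

∣support∣≤totalDeg : ∀ {n} (b : Mon n) → ∣ support b ∣ ≤ totalDeg b
∣support∣≤totalDeg []          = z≤n
∣support∣≤totalDeg (zero ∷ b)  = ∣support∣≤totalDeg b
∣support∣≤totalDeg (suc d ∷ b) = s≤s (ℕ.≤-trans (∣support∣≤totalDeg b) (ℕ.m≤n+m _ d))

module _ {n : ℕ} where

  totalDeg≤deg : ∀ (p : Poly n) m → coeff p m ≡ true → totalDeg m ≤ deg p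
  totalDeg≤deg p m p∋m =
    ∈⇒≤foldr⊔ _ (∈-map⁺ totalDeg (∈-filter⁺ (λ m → coeff p m Data.Bool.≟ true) (coeff-true⇒∈ p m p∋m) p∋m))

  deg≤ : ∀ (p : Poly n) d → (∀ m → coeff p m ≡ true → totalDeg m ≤ d) → deg p ≤ d
  deg≤ p d bound = foldr⊔-lub _ (AllP.map⁺ (All.map (λ {m} → bound m) (AllP.all-filter (λ m → coeff p m Data.Bool.≟ true) p)))

  deg-resp-≈ : ∀ {p q : Poly n} → p ≈ₚ q → deg p ≡ deg q
  deg-resp-≈ {p} {q} p≈q = ℕ.≤-antisym (deg≤ p (deg q) (λ m c → totalDeg≤deg q m (trans (sym (p≈q m)) c)))
                                       (deg≤ q (deg p) (λ m c → totalDeg≤deg p m (trans (p≈q m) c)))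

  ∣S∣≤deg : ∀ (S : Subset n) p → mobius S (λ c → eval c p) ≡ true → ∣ S ∣ ≤ deg p
  ∣S∣≤deg S p odd with parity-true⇒coeff (λ b → support b == S) p (trans (sym (mobius-eval S p)) odd)
  ... | b , p∋b , supp-b =
    subst (λ T → ∣ T ∣ ≤ deg p) (==⇒≡ (support b) S supp-b)
          (ℕ.≤-trans (∣support∣≤totalDeg b) (totalDeg≤deg p b p∋b))

totalDeg-+ : ∀ {n} (a b : Mon n) → totalDeg (zipWith _+_ a b) ≡ totalDeg a + totalDeg b
totalDeg-+ []      []      = refl
totalDeg-+ (d ∷ a) (e ∷ b) = trans (cong ((d + e) +_) (totalDeg-+ a b)) (+-interchange d e (totalDeg a) (totalDeg b))

totalDeg-var : ∀ {n} (i : Fin n) → totalDeg (tabulate (λ j → if does (i Fin.≟ j) then 1 else 0)) ≡ 1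
totalDeg-var {suc n} Fin.zero    = cong suc (zeros {n} (λ _ → 0) (λ _ → refl))
  where
  zeros : ∀ {m} (f : Fin m → ℕ) → (∀ j → f j ≡ 0) → totalDeg (tabulate f) ≡ 0
  zeros {zero}  f f≡0 = refl
  zeros {suc m} f f≡0 rewrite f≡0 Fin.zero = zeros (λ j → f (Fin.suc j)) (λ j → f≡0 (Fin.suc j))
totalDeg-var {suc n} (Fin.suc i) = totalDeg-var i

module _ {n : ℕ} where

  deg-X*X≤2 : ∀ (i j : Fin n) → deg (X i *ₚ X j) ≤ 2
  deg-X*X≤2 i j = deg≤ (X i *ₚ X j) 2 bound
    where
    bound : ∀ m → coeff (X i *ₚ X j) m ≡ true → totalDeg m ≤ 2
    bound m odd with coeff-true⇒∈ (X i *ₚ X j) m odd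
    ... | Any.here refl rewrite totalDeg-+ (tabulate (λ l → if does (i Fin.≟ l) then 1 else 0))
                                           (tabulate (λ l → if does (j Fin.≟ l) then 1 else 0))
                              | totalDeg-var i | totalDeg-var j = ℕ.≤-refl

  ∣σ∪τ∣≤deg-pm : ∀ {σ τ : Subset n} → Disjoint σ τ → ∣ σ ∪ τ ∣ ≤ deg (pm σ τ)
  ∣σ∪τ∣≤deg-pm {σ} {τ} σ∩τ=∅ =
    ∣S∣≤deg (σ ∪ τ) (pm σ τ) (trans (mobius-cong (σ ∪ τ) (λ c → eval-pm c σ τ)) (mobius-fits σ τ σ∩τ=∅))

module _ {n : ℕ} where

  SquarefreeIn : (Fin n → Set) → Mon n → Set
  SquarefreeIn Q m = ∀ x → lookup m x ≡ 0 ⊎ (lookup m x ≡ 1 × Q x)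

  SquarefreeIn-mono : ∀ {P Q : Fin n → Set} → (∀ {x} → P x → Q x) → ∀ {p} →
    All (SquarefreeIn P) p → All (SquarefreeIn Q) p
  SquarefreeIn-mono P⇒Q = All.map (λ sq x → Sum.map₂ (Product.map₂ P⇒Q) (sq x))

  SquarefreeIn⇒Multilinear : ∀ {Q p} → All (SquarefreeIn Q) p → Multilinear p
  SquarefreeIn⇒Multilinear = All.map (λ sq x → ≤1 (sq x))
    where
    ≤1 : ∀ {d} {A : Set} → d ≡ 0 ⊎ (d ≡ 1 × A) → d ≤ 1
    ≤1 (inj₁ refl)       = z≤n
    ≤1 (inj₂ (refl , _)) = ℕ.≤-refl

  All-*ₚ : ∀ {P Q R : Mon n → Set} {p q : Poly n} → All P p → All Q q →
    (∀ {a b} → P a → Q b → R (zipWith _+_ a b)) → All R (p *ₚ q)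
  All-*ₚ []           all-q comb = []
  All-*ₚ (Pa ∷ all-p) all-q comb = AllP.++⁺ (AllP.map⁺ (All.map (comb Pa) all-q)) (All-*ₚ all-p all-q comb)

  *-SquarefreeIn : ∀ {P Q : Fin n → Set} {p q : Poly n} → (∀ x → P x → ¬ Q x) →
    All (SquarefreeIn P) p → All (SquarefreeIn Q) q → All (SquarefreeIn (λ x → P x ⊎ Q x)) (p *ₚ q)
  *-SquarefreeIn {P} {Q} P∩Q=∅ all-p all-q = All-*ₚ all-p all-q (λ {a} {b} → comb {a} {b})
    where
    comb : ∀ {a b} → SquarefreeIn P a → SquarefreeIn Q b → SquarefreeIn (λ x → P x ⊎ Q x) (zipWith _+_ a b)
    comb {a} {b} sq-a sq-b x rewrite lookup-zipWith _+_ x a b with sq-a x | sq-b x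
    ... | inj₁ a0        | inj₁ b0        rewrite a0 | b0 = inj₁ refl
    ... | inj₁ a0        | inj₂ (b1 , Qx) rewrite a0 | b1 = inj₂ (refl , inj₂ Qx)
    ... | inj₂ (a1 , Px) | inj₁ b0        rewrite a1 | b0 = inj₂ (refl , inj₁ Px)
    ... | inj₂ (_ , Px)  | inj₂ (_ , Qx)  = ⊥-elim (P∩Q=∅ x Px Qx)

  1ₚ-SquarefreeIn : ∀ {Q} → All (SquarefreeIn Q) 1ₚ
  1ₚ-SquarefreeIn = (λ x → inj₁ (lookup-replicate x 0)) ∷ []

  X-SquarefreeIn : ∀ (l : Fin n) → All (SquarefreeIn (l ≡_)) (X l)
  X-SquarefreeIn l = sq ∷ []
    where
    sq : SquarefreeIn (l ≡_) (tabulate (λ j → if does (l Fin.≟ j) then 1 else 0))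
    sq x rewrite lookup∘tabulate (λ j → if does (l Fin.≟ j) then 1 else 0) x with l Fin.≟ x
    ... | yes l≡x = inj₂ (refl , l≡x)
    ... | no  _   = inj₁ refl

  prod-SquarefreeIn : ∀ (G : Fin n → Poly n) (Q : Fin n → Fin n → Set) →
    (∀ l → All (SquarefreeIn (Q l)) (G l)) → (∀ {l x} → Q l x → l ≡ x) →
    ∀ {m} (f : Fin m → Fin n) → (∀ {r s} → f r ≡ f s → r ≡ s) →
    All (SquarefreeIn (λ x → ∃[ r ] Q (f r) x)) (prodₚ (map G (List.tabulate f)))
  prod-SquarefreeIn G Q sq-G Q⇒≡ {zero}  f f-inj = 1ₚ-SquarefreeIn
  prod-SquarefreeIn G Q sq-G Q⇒≡ {suc m} f f-inj =
    SquarefreeIn-mono [ (λ q → Fin.zero , q) , (λ { (r , q) → Fin.suc r , q }) ]′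
      (*-SquarefreeIn disjoint (sq-G (f Fin.zero))
        (prod-SquarefreeIn G Q sq-G Q⇒≡ (λ r → f (Fin.suc r)) (λ e → suc-injective (f-inj e))))
    where
    disjoint : ∀ x → Q (f Fin.zero) x → ¬ (∃[ r ] Q (f (Fin.suc r)) x)
    disjoint x q₀ (r , qᵣ) with f-inj (trans (Q⇒≡ q₀) (sym (Q⇒≡ qᵣ)))
    ... | ()

  factor-SquarefreeIn : ∀ σ τ (l : Fin n) → All (SquarefreeIn (λ x → l ≡ x × x ∈ σ ∪ τ)) (factor σ τ l)
  factor-SquarefreeIn σ τ l with lookup σ l in σl | lookup τ l in τl
  ... | true  | _     = SquarefreeIn-mono (λ { refl → refl , x∈p∪q⁺ (inj₁ (lookup⇒∈ σl)) }) (X-SquarefreeIn l)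
  ... | false | true  = AllP.++⁺ 1ₚ-SquarefreeIn
                          (SquarefreeIn-mono (λ { refl → refl , x∈p∪q⁺ (inj₂ (lookup⇒∈ τl)) }) (X-SquarefreeIn l))
  ... | false | false = 1ₚ-SquarefreeIn

  pm-SquarefreeIn : ∀ σ τ → All (SquarefreeIn (_∈ σ ∪ τ)) (pm σ τ)
  pm-SquarefreeIn σ τ =
    SquarefreeIn-mono (λ { (_ , _ , x∈σ∪τ) → x∈σ∪τ })
      (prod-SquarefreeIn (factor σ τ) (λ l x → l ≡ x × x ∈ σ ∪ τ) (factor-SquarefreeIn σ τ) proj₁ (λ l → l) (λ e → e))

  pm-multilinear : ∀ σ τ → Multilinear (pm σ τ)
  pm-multilinear σ τ = SquarefreeIn⇒Multilinear (pm-SquarefreeIn σ τ)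

-- Neural ideals

allVecs : ∀ n → List (Vec Bool n)
allVecs zero    = [] ∷ []
allVecs (suc n) = map (true ∷_) (allVecs n) ++ map (false ∷_) (allVecs n)

parity-allVecs : ∀ {n} (H : Vec Bool n → Bool) c → parity (λ v → (v == c) ∧ H v) (allVecs n) ≡ H c
parity-allVecs {zero}  H []      = xor-identityʳ (H [])
parity-allVecs {suc n} H (x ∷ c) = begin
  parity F (map (true ∷_) (allVecs n) ++ map (false ∷_) (allVecs n))
    ≡⟨ parity-++ F (map (true ∷_) (allVecs n)) (map (false ∷_) (allVecs n)) ⟩
  parity F (map (true ∷_) (allVecs n)) xor parity F (map (false ∷_) (allVecs n))
    ≡⟨ cong₂ _xor_ (parity-map F (true ∷_) (allVecs n)) (parity-map F (false ∷_) (allVecs n)) ⟩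
  parity (λ v → F (true ∷ v)) (allVecs n) xor parity (λ v → F (false ∷ v)) (allVecs n)
    ≡⟨ split x ⟩
  H (x ∷ c)
    ∎
  where
  F : Vec Bool (suc n) → Bool
  F v = (v == x ∷ c) ∧ H v
  split : ∀ x → parity (λ v → ((true ∷ v) == x ∷ c) ∧ H (true ∷ v)) (allVecs n)
                  xor parity (λ v → ((false ∷ v) == x ∷ c) ∧ H (false ∷ v)) (allVecs n)
                ≡ H (x ∷ c)
  split true  = trans (cong₂ _xor_ (parity-allVecs (λ v → H (true ∷ v)) c) (parity-false (allVecs n))) (xor-identityʳ _)
  split false = cong₂ _xor_ (parity-false (allVecs n)) (parity-allVecs (λ v → H (false ∷ v)) c)

parity-filter : ∀ {A : Set} F (H : A → Bool) xs →
  parity F (List.filter (λ v → H v Data.Bool.≟ true) xs) ≡ parity (λ v → H v ∧ F v) xs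
parity-filter F H []       = refl
parity-filter F H (x ∷ xs) with H x
... | true  = cong (F x xor_) (parity-filter F H xs)
... | false = parity-filter F H xs

module _ {n : ℕ} where

  eval-ρ : ∀ c (v : Subset n) → eval c (ρ v) ≡ (v == c)
  eval-ρ c v = trans (eval-pm c v (∁ v)) (fits-∁ v c)
    where
    literal-∁ : ∀ s x → literal s (not s) x ≡ not (s xor x)
    literal-∁ true  x = sym (not-involutive x)
    literal-∁ false x = refl
    fits-∁ : ∀ {m} (v c : Vec Bool m) → fits v (∁ v) c ≡ (v == c)
    fits-∁ []      []      = refl
    fits-∁ (s ∷ v) (x ∷ c) = cong₂ _∧_ (literal-∁ s x) (fits-∁ v c)

  neuralIdeal-resp-≈ : ∀ {C : Code {n}} {f g} → f ≈ₚ g → neuralIdeal C g → neuralIdeal C f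
  neuralIdeal-resp-≈ f≈g (hgs , gens , g≈sum) = hgs , gens , λ m → trans (f≈g m) (g≈sum m)

  combination : List (Poly n × Poly n) → Poly n
  combination hgs = sumₚ (map (λ hg → proj₁ hg *ₚ proj₂ hg) hgs)

  eval-combination : ∀ c hgs → eval c (combination hgs) ≡ parity (λ hg → eval c (proj₁ hg *ₚ proj₂ hg)) hgs
  eval-combination c hgs = trans (eval-sum c (map (λ hg → proj₁ hg *ₚ proj₂ hg) hgs))
                                 (parity-map (eval c) (λ hg → proj₁ hg *ₚ proj₂ hg) hgs)

  neuralIdeal-vanishes : ∀ (C : Code {n}) {g} → neuralIdeal C g → ∀ c → C c → eval c g ≡ false
  neuralIdeal-vanishes C {g} (hgs , gens , g≈sum) c c∈C = begin
    eval c g                                            ≡⟨ eval-resp-≈ c {g} {combination hgs} g≈sum ⟩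
    eval c (combination hgs)                            ≡⟨ eval-combination c hgs ⟩
    parity (λ hg → eval c (proj₁ hg *ₚ proj₂ hg)) hgs  ≡⟨ parity-congᴬ (All.map (λ {hg} → generator-vanishes hg) gens) ⟩
    parity (λ _ → false) hgs                            ≡⟨ parity-false hgs ⟩
    false                                               ∎
    where
    generator-vanishes : ∀ hg → (∃[ v ] (¬ C v × proj₂ hg ≡ ρ v)) → eval c (proj₁ hg *ₚ proj₂ hg) ≡ false
    generator-vanishes (h , _) (v , v∉C , refl) with v == c in v=c
    ... | true  = contradiction (subst C (sym (==⇒≡ v c v=c)) c∈C) v∉C
    ... | false = begin
      eval c (h *ₚ ρ v)         ≡⟨ eval-* c h (ρ v) ⟩
      eval c h ∧ eval c (ρ v)   ≡⟨ cong (eval c h ∧_) (trans (eval-ρ c v) v=c) ⟩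
      eval c h ∧ false          ≡⟨ ∧-zeroʳ (eval c h) ⟩
      false                     ∎

  -- Interpolation: p agrees with the sum of the  ρ v  over the points v with p(v) = 1, none of which is in C.
  vanishing⇒∈neuralIdeal : ∀ (C : Code {n}) {p} → Multilinear p → (∀ c → C c → eval c p ≡ false) → neuralIdeal C p
  vanishing⇒∈neuralIdeal C {p} ml-p vanishes = hgs , gens , multilinear-ext ml-p ml-sum same-values
    where
    vs : List (Subset n)
    vs = List.filter (λ v → eval v p Data.Bool.≟ true) (allVecs n)
    hgs : List (Poly n × Poly n)
    hgs = map (λ v → 1ₚ , ρ v) vs
    gens : All (λ hg → ∃[ v ] (¬ C v × proj₂ hg ≡ ρ v)) hgs
    gens = AllP.map⁺ (All.map (λ {v} p[v] → v , (λ v∈C → contradiction (trans (sym p[v]) (vanishes v v∈C)) λ ()) , refl)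
                              (AllP.all-filter (λ v → eval v p Data.Bool.≟ true) (allVecs n)))
    ml-sum : Multilinear (combination hgs)
    ml-sum = AllP.concat⁺ (AllP.map⁺ (AllP.map⁺ (All.universal term-multilinear vs)))
      where
      term-multilinear : ∀ v → Multilinear (1ₚ *ₚ ρ v)
      term-multilinear v =
        SquarefreeIn⇒Multilinear (*-SquarefreeIn {P = _∈ ⊥} (λ x x∈⊥ _ → ∉⊥ x∈⊥) 1ₚ-SquarefreeIn (pm-SquarefreeIn v (∁ v)))
    same-values : ∀ c → eval c p ≡ eval c (combination hgs)
    same-values c = sym (begin
      eval c (combination hgs)                                 ≡⟨ eval-combination c hgs ⟩
      parity (λ hg → eval c (proj₁ hg *ₚ proj₂ hg)) hgs       ≡⟨ parity-map (λ hg → eval c (proj₁ hg *ₚ proj₂ hg)) (λ v → 1ₚ , ρ v) vs ⟩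
      parity (λ v → eval c (1ₚ *ₚ ρ v)) vs                     ≡⟨ parity-cong term-value vs ⟩
      parity (λ v → v == c) vs                                 ≡⟨ parity-filter (_== c) (λ v → eval v p) (allVecs n) ⟩
      parity (λ v → eval v p ∧ (v == c)) (allVecs n)           ≡⟨ parity-cong (λ v → ∧-comm (eval v p) (v == c)) (allVecs n) ⟩
      parity (λ v → (v == c) ∧ eval v p) (allVecs n)           ≡⟨ parity-allVecs (λ v → eval v p) c ⟩
      eval c p                                                 ∎)
      where
      term-value : ∀ v → eval c (1ₚ *ₚ ρ v) ≡ (v == c)
      term-value v = trans (eval-* c 1ₚ (ρ v)) (cong₂ _∧_ (eval-1ₚ c) (eval-ρ c v))

  pm∈neuralIdeal : ∀ (C : Code {n}) {σ τ} → Disjoint σ τ →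
    (∀ c → C c → ¬ (σ ⊆ c × τ ⊆ ∁ c)) → neuralIdeal C (pm σ τ)
  pm∈neuralIdeal C {σ} {τ} σ∩τ=∅ no-codeword = vanishing⇒∈neuralIdeal C (pm-multilinear σ τ) vanishes
    where
    vanishes : ∀ c → C c → eval c (pm σ τ) ≡ false
    vanishes c c∈C with fits σ τ c in fit
    ... | true  = contradiction (fits⁻ σ∩τ=∅ fit) (no-codeword c c∈C)
    ... | false = trans (eval-pm c σ τ) fit

  ∈neuralIdeal⇒no-codeword : ∀ (C : Code {n}) {g σ τ} → g ≈ₚ pm σ τ → neuralIdeal C g →
    ∀ c → C c → ¬ (σ ⊆ c × τ ⊆ ∁ c)
  ∈neuralIdeal⇒no-codeword C {g} {σ} {τ} g≈pm g∈J c c∈C (σ⊆c , τ⊆∁c) =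
    contradiction (trans (sym (neuralIdeal-vanishes C {g} g∈J c c∈C)) g[c]) λ ()
    where
    g[c] : eval c g ≡ true
    g[c] = trans (eval-resp-≈ c {g} {pm σ τ} g≈pm) (trans (eval-pm c σ τ) (fits⁺ σ⊆c τ⊆∁c))

  divisor-fits : ∀ {f h g : Poly n} {σ τ} c → Disjoint σ τ → g ≈ₚ pm σ τ → f ≈ₚ h *ₚ g →
    eval c f ≡ true → σ ⊆ c × τ ⊆ ∁ c
  divisor-fits {f} {h} {g} {σ} {τ} c σ∩τ=∅ g≈pm f≈hg f[c] = fits⁻ σ∩τ=∅ (begin
    fits σ τ c         ≡⟨ sym (eval-pm c σ τ) ⟩
    eval c (pm σ τ)    ≡⟨ sym (eval-resp-≈ c {g} {pm σ τ} g≈pm) ⟩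
    eval c g           ≡⟨ proj₂ (∧-true⁻ (trans (sym (eval-* c h g)) (trans (sym (eval-resp-≈ c {f} {h *ₚ g} f≈hg)) f[c]))) ⟩
    true               ∎)

  minimal-if-divisors-≈ : ∀ (J : Ideal {n}) {f} →
    (∀ {g h σ τ} → Disjoint σ τ → g ≈ₚ pm σ τ → J g → f ≈ₚ h *ₚ g → g ≈ₚ f) → IsMinimalPM J f
  minimal-if-divisors-≈ J {f} divisor≈f (g , (σ , τ , σ∩τ=∅ , g≈pm) , g∈J , deg-g<deg-f , h , f≈hg) =
    ℕ.<-irrefl (deg-resp-≈ {p = g} {q = f} (divisor≈f {g} {h} {σ} {τ} σ∩τ=∅ g≈pm g∈J f≈hg)) deg-g<deg-f

module _ {n : ℕ} where

  allOff : Poly n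
  allOff = prodₚ (map 1-X (allFin n))

  pm-⊥-⊤ : pm ⊥ ⊤ ≡ allOff
  pm-⊥-⊤ = cong prodₚ (ListP.map-cong factor-⊥-⊤ (allFin n))
    where
    factor-⊥-⊤ : ∀ l → factor ⊥ ⊤ l ≡ 1-X l
    factor-⊥-⊤ l rewrite lookup-replicate l false | lookup-replicate l true = refl

  empty-σ⇒≈allOff : ∀ (C : Code {n}) → (∀ a → C ⁅ a ⁆) → ∀ {g σ τ} → g ≈ₚ pm σ τ → neuralIdeal C g →
    (∀ l → l ∉ σ) → g ≈ₚ allOff
  empty-σ⇒≈allOff C singletons {g} {σ} {τ} g≈pm g∈J σ-empty =
    subst (g ≈ₚ_) (trans (cong₂ pm σ≡⊥ τ≡⊤) pm-⊥-⊤) g≈pm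
    where
    τ-full : ∀ l → l ∈ τ
    τ-full l with l ∈? τ
    ... | yes l∈τ = l∈τ
    ... | no  l∉τ = ⊥-elim (∈neuralIdeal⇒no-codeword C {g = g} g≈pm g∈J ⁅ l ⁆ (singletons l)
                              ((λ {x} x∈σ → ⊥-elim (σ-empty x x∈σ)) , τ⊆∁⁅l⁆))
      where
      τ⊆∁⁅l⁆ : τ ⊆ ∁ ⁅ l ⁆
      τ⊆∁⁅l⁆ {x} x∈τ = x∉p⇒x∈∁p (λ x∈⁅l⁆ → l∉τ (subst (_∈ τ) (x∈⁅y⁆⇒x≡y l x∈⁅l⁆) x∈τ))
    σ≡⊥ : σ ≡ ⊥
    σ≡⊥ = Empty-unique (λ { (x , x∈σ) → σ-empty x x∈σ })
    τ≡⊤ : τ ≡ ⊤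
    τ≡⊤ = ⊆-antisym ⊆⊤ (λ {x} _ → τ-full x)

  X*X-SquarefreeIn : ∀ {i j : Fin n} → i ≢ j → All (SquarefreeIn (λ x → i ≡ x ⊎ j ≡ x)) (X i *ₚ X j)
  X*X-SquarefreeIn i≢j = *-SquarefreeIn (λ x i≡x j≡x → i≢j (trans i≡x (sym j≡x))) (X-SquarefreeIn _) (X-SquarefreeIn _)

  X*X≈pm : ∀ {i j : Fin n} → i ≢ j → X i *ₚ X j ≈ₚ pm (⁅ i ⁆ ∪ ⁅ j ⁆) ⊥
  X*X≈pm {i} {j} i≢j =
    multilinear-ext (SquarefreeIn⇒Multilinear (X*X-SquarefreeIn i≢j)) (pm-multilinear (⁅ i ⁆ ∪ ⁅ j ⁆) ⊥) same-values
    where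
    same-values : ∀ c → eval c (X i *ₚ X j) ≡ eval c (pm (⁅ i ⁆ ∪ ⁅ j ⁆) ⊥)
    same-values c = trans (eval-X*X c i j) (trans (≡true-ext to from) (sym (eval-pm c (⁅ i ⁆ ∪ ⁅ j ⁆) ⊥)))
      where
      to : (lookup c i ∧ lookup c j) ≡ true → fits (⁅ i ⁆ ∪ ⁅ j ⁆) ⊥ c ≡ true
      to cᵢ∧cⱼ = fits⁺ {σ = ⁅ i ⁆ ∪ ⁅ j ⁆} {τ = ⊥} {c = c}
                       (pair⊆ (lookup⇒∈ (proj₁ (∧-true⁻ cᵢ∧cⱼ))) (lookup⇒∈ (proj₂ (∧-true⁻ cᵢ∧cⱼ))))
                       (λ l∈⊥ → contradiction l∈⊥ ∉⊥)
      from : fits (⁅ i ⁆ ∪ ⁅ j ⁆) ⊥ c ≡ true → (lookup c i ∧ lookup c j) ≡ true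
      from fit with fits⁻ {σ = ⁅ i ⁆ ∪ ⁅ j ⁆} {τ = ⊥} {c = c} (Disjoint-⊥ (⁅ i ⁆ ∪ ⁅ j ⁆)) fit
      ... | pair⊆c , _ rewrite ∈⇒lookup (pair⊆c (i∈pair i j)) | ∈⇒lookup (pair⊆c (j∈pair i j)) = refl

  pm≈pm*X*X : ∀ {σ τ} {i j : Fin n} → Disjoint σ τ → i ∈ σ → j ∈ σ → i ≢ j →
    pm σ τ ≈ₚ pm (σ - i - j) τ *ₚ (X i *ₚ X j)
  pm≈pm*X*X {σ} {τ} {i} {j} σ∩τ=∅ i∈σ j∈σ i≢j = multilinear-ext (pm-multilinear σ τ) multilinear same-values
    where
    σ′ = σ - i - j
    σ′⊆σ : σ′ ⊆ σ
    σ′⊆σ x∈σ′ = p─q⊆p σ ⁅ i ⁆ (p─q⊆p (σ - i) ⁅ j ⁆ x∈σ′)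
    i∉σ′ : i ∉ σ′
    i∉σ′ i∈σ′ = x∈p─q⇒x∉q σ ⁅ i ⁆ (p─q⊆p (σ - i) ⁅ j ⁆ i∈σ′) (x∈⁅x⁆ i)
    j∉σ′ : j ∉ σ′
    j∉σ′ j∈σ′ = x∈p─q⇒x∉q (σ - i) ⁅ j ⁆ j∈σ′ (x∈⁅x⁆ j)
    σ′∪τ∌i,j : ∀ x → x ∈ σ′ ∪ τ → ¬ (i ≡ x ⊎ j ≡ x)
    σ′∪τ∌i,j x x∈σ′∪τ i∨j with x∈p∪q⁻ σ′ τ x∈σ′∪τ | i∨j
    ... | inj₁ x∈σ′ | inj₁ refl = i∉σ′ x∈σ′
    ... | inj₁ x∈σ′ | inj₂ refl = j∉σ′ x∈σ′
    ... | inj₂ x∈τ  | inj₁ refl = σ∩τ=∅ i (i∈σ , x∈τ)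
    ... | inj₂ x∈τ  | inj₂ refl = σ∩τ=∅ j (j∈σ , x∈τ)
    multilinear : Multilinear (pm σ′ τ *ₚ (X i *ₚ X j))
    multilinear = SquarefreeIn⇒Multilinear (*-SquarefreeIn σ′∪τ∌i,j (pm-SquarefreeIn σ′ τ) (X*X-SquarefreeIn i≢j))
    σ′∩τ=∅ : Disjoint σ′ τ
    σ′∩τ=∅ x (x∈σ′ , x∈τ) = σ∩τ=∅ x (σ′⊆σ x∈σ′ , x∈τ)
    same-values : ∀ c → eval c (pm σ τ) ≡ eval c (pm σ′ τ *ₚ (X i *ₚ X j))
    same-values c = begin
      eval c (pm σ τ)                                      ≡⟨ eval-pm c σ τ ⟩
      fits σ τ c                                           ≡⟨ ≡true-ext to from ⟩
      fits σ′ τ c ∧ (lookup c i ∧ lookup c j)              ≡⟨ sym (cong₂ _∧_ (eval-pm c σ′ τ) (eval-X*X c i j)) ⟩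
      eval c (pm σ′ τ) ∧ eval c (X i *ₚ X j)               ≡⟨ sym (eval-* c (pm σ′ τ) (X i *ₚ X j)) ⟩
      eval c (pm σ′ τ *ₚ (X i *ₚ X j))                     ∎
      where
      to : fits σ τ c ≡ true → (fits σ′ τ c ∧ (lookup c i ∧ lookup c j)) ≡ true
      to fit with fits⁻ {c = c} σ∩τ=∅ fit
      ... | σ⊆c , τ⊆∁c rewrite fits⁺ (λ x∈σ′ → σ⊆c (σ′⊆σ x∈σ′)) τ⊆∁c | ∈⇒lookup (σ⊆c i∈σ) | ∈⇒lookup (σ⊆c j∈σ) = refl
      from : (fits σ′ τ c ∧ (lookup c i ∧ lookup c j)) ≡ true → fits σ τ c ≡ true
      from fit∧cᵢ∧cⱼ with ∧-true⁻ fit∧cᵢ∧cⱼ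
      ... | fit , cᵢ∧cⱼ with fits⁻ {c = c} σ′∩τ=∅ fit | ∧-true⁻ cᵢ∧cⱼ
      ... | σ′⊆c , τ⊆∁c | cᵢ , cⱼ = fits⁺ σ⊆c τ⊆∁c
        where
        σ⊆c : σ ⊆ c
        σ⊆c {x} x∈σ with x Fin.≟ i | x Fin.≟ j
        ... | yes refl | _        = lookup⇒∈ cᵢ
        ... | no  _    | yes refl = lookup⇒∈ cⱼ
        ... | no  x≢i  | no  x≢j  = σ′⊆c (x∈p∧x≢y⇒x∈p-y (x∈p∧x≢y⇒x∈p-y x∈σ x≢i) x≢j)

-- Neuron r is the index r − 1, so C_R(k) consists of the vertices and the edges of the
-- k-cycle 0 − 1 − ⋯ − (k−1) − 0.
CycleEdge : ℕ → ℕ → ℕ → Set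
CycleEdge k j i = i ≡ suc j ⊎ (j ≡ 0 × i ≡ k ∸ 1)

IsChord : (k : ℕ) → Fin k → Fin k → Set
IsChord k i j = toℕ j < toℕ i × toℕ i ∸ toℕ j ≢ 1 × toℕ i ∸ toℕ j ≢ k ∸ 1

isChord? : ∀ k (i j : Fin k) → Dec (IsChord k i j)
isChord? k i j = (toℕ j ℕ.<? toℕ i) ×-dec (¬? (toℕ i ∸ toℕ j ℕ.≟ 1) ×-dec ¬? (toℕ i ∸ toℕ j ℕ.≟ k ∸ 1))

module _ {k : ℕ} where

  chord⇒≢ : ∀ {i j : Fin k} → IsChord k i j → i ≢ j
  chord⇒≢ (j<i , _) refl = ℕ.<-irrefl refl j<i

  chord⇒¬edge : ∀ {i j : Fin k} → IsChord k i j → ¬ CycleEdge k (toℕ j) (toℕ i)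
  chord⇒¬edge {i} {j} (_ , i-j≢1 , _)   (inj₁ i≡1+j)       = i-j≢1 (trans (cong (_∸ toℕ j) i≡1+j) (ℕ.m+n∸n≡m 1 (toℕ j)))
  chord⇒¬edge {i} {j} (_ , _ , i-j≢k-1) (inj₂ (j≡0 , i≡k-1)) rewrite j≡0 = i-j≢k-1 i≡k-1

  chord⇒¬reverse-edge : ∀ {i j : Fin k} → IsChord k i j → ¬ CycleEdge k (toℕ i) (toℕ j)
  chord⇒¬reverse-edge (j<i , _) (inj₁ j≡1+i)      = ℕ.<-asym j<i (subst (toℕ _ <_) (sym j≡1+i) (ℕ.n<1+n _))
  chord⇒¬reverse-edge (j<i , _) (inj₂ (i≡0 , _)) = ℕ.n≮0 (subst (_ <_) i≡0 j<i)

  chord-not-in-edge : ∀ {i j a b : Fin k} → IsChord k i j → CycleEdge k (toℕ a) (toℕ b) →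
    i ∈ ⁅ a ⁆ ∪ ⁅ b ⁆ → j ∈ ⁅ a ⁆ ∪ ⁅ b ⁆ → ⊥ᵉ
  chord-not-in-edge {i} {j} {a} {b} chord edge i∈ab j∈ab with pair-member i∈ab | pair-member j∈ab
  ... | inj₁ refl | inj₁ refl = chord⇒≢ chord refl
  ... | inj₂ refl | inj₂ refl = chord⇒≢ chord refl
  ... | inj₁ refl | inj₂ refl = chord⇒¬reverse-edge chord edge
  ... | inj₂ refl | inj₁ refl = chord⇒¬edge chord edge

  chord-not-in-codeword : ∀ {i j c} → IsChord k i j → CR k c → i ∈ c → j ∈ c → ⊥ᵉ
  chord-not-in-codeword chord (inj₁ (a , refl)) i∈c j∈c =
    chord⇒≢ chord (trans (x∈⁅y⁆⇒x≡y _ i∈c) (sym (x∈⁅y⁆⇒x≡y _ j∈c)))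
  chord-not-in-codeword chord (inj₂ (inj₁ (a , b , b≡1+a , refl))) =
    chord-not-in-edge chord (inj₁ b≡1+a)
  chord-not-in-codeword chord (inj₂ (inj₂ (a , b , a≡0 , b≡k-1 , refl))) =
    chord-not-in-edge chord (inj₂ (a≡0 , b≡k-1))

  codeword-nonempty : ∀ {c} → CR k c → ∃[ a ] a ∈ c
  codeword-nonempty (inj₁ (a , refl))                 = a , x∈⁅x⁆ a
  codeword-nonempty (inj₂ (inj₁ (a , b , _ , refl)))     = a , i∈pair a b
  codeword-nonempty (inj₂ (inj₂ (a , b , _ , _ , refl))) = a , i∈pair a b

  edge⇒codeword : ∀ {a b : Fin k} → CycleEdge k (toℕ a) (toℕ b) → CR k (⁅ a ⁆ ∪ ⁅ b ⁆)
  edge⇒codeword {a} {b} (inj₁ b≡1+a)          = inj₂ (inj₁ (a , b , b≡1+a , refl))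
  edge⇒codeword {a} {b} (inj₂ (a≡0 , b≡k-1)) = inj₂ (inj₂ (a , b , a≡0 , b≡k-1 , refl))

x∸y≡m⇒y≡0×x≡m : ∀ {m} x y → x ≤ m → y ≤ x → x ∸ y ≡ m → y ≡ 0 × x ≡ m
x∸y≡m⇒y≡0×x≡m x zero    _   _   x≡m   = refl , x≡m
x∸y≡m⇒y≡0×x≡m {m} x (suc y) x≤m y<x x-y≡m = contradiction (subst (_≤ m) x≡m+1+y x≤m) (ℕ.m+1+n≰m m)
  where
  x≡m+1+y : x ≡ m + suc y
  x≡m+1+y = trans (sym (ℕ.m∸n+n≡m y<x)) (cong (_+ suc y) x-y≡m)

not-chord⇒edge : ∀ {k} {i j : Fin k} → toℕ j < toℕ i → ¬ IsChord k i j → CycleEdge k (toℕ j) (toℕ i)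
not-chord⇒edge {suc m} {i} {j} j<i ¬chord with toℕ i ∸ toℕ j ℕ.≟ 1 | toℕ i ∸ toℕ j ℕ.≟ m
... | yes i-j≡1 | _         = inj₁ (trans (sym (ℕ.m∸n+n≡m (ℕ.<⇒≤ j<i))) (cong (_+ toℕ j) i-j≡1))
... | no  _     | yes i-j≡m = inj₂ (x∸y≡m⇒y≡0×x≡m (toℕ i) (toℕ j) (ℕ.s≤s⁻¹ (toℕ<n i)) (ℕ.<⇒≤ j<i) i-j≡m)
... | no  i-j≢1 | no i-j≢m  = contradiction (j<i , i-j≢1 , i-j≢m) ¬chord

no-triangle : ∀ {k x y z} → 4 ≤ k → x < y → y < z →
  CycleEdge k x y → CycleEdge k y z → CycleEdge k x z → ⊥ᵉ
no-triangle _   x<y y<z _                  _                  (inj₁ refl)           =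
  ℕ.<-irrefl refl (ℕ.<-≤-trans x<y (ℕ.s≤s⁻¹ y<z))
no-triangle _   x<y y<z (inj₂ (_ , refl))  _                  (inj₂ (_ , refl))     = ℕ.<-irrefl refl y<z
no-triangle _   x<y y<z (inj₁ refl)        (inj₂ (() , _))    (inj₂ (refl , _))
no-triangle 4≤k x<y y<z (inj₁ refl)        (inj₁ refl)        (inj₂ (refl , 2≡k-1)) =
  ℕ.<-irrefl refl (subst (2 <_) (sym 2≡k-1) (ℕ.∸-monoˡ-≤ 1 4≤k))

module _ {k : ℕ} where

  in-order : ∀ (P : Fin k → Set) {a b c} → P a → P b → P c → a ≢ b → a ≢ c → b ≢ c →
    ∃[ x ] ∃[ y ] ∃[ z ] (P x × P y × P z × toℕ x < toℕ y × toℕ y < toℕ z)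
  in-order P {a} {b} {c} Pa Pb Pc a≢b a≢c b≢c with ℕ.<-cmp (toℕ a) (toℕ b) | ℕ.<-cmp (toℕ b) (toℕ c) | ℕ.<-cmp (toℕ a) (toℕ c)
  ... | tri≈ _ a≡b _ | _ | _ = contradiction (toℕ-injective a≡b) a≢b
  ... | _ | tri≈ _ b≡c _ | _ = contradiction (toℕ-injective b≡c) b≢c
  ... | _ | _ | tri≈ _ a≡c _ = contradiction (toℕ-injective a≡c) a≢c
  ... | tri< a<b _ _ | tri< b<c _ _ | _            = a , b , c , Pa , Pb , Pc , a<b , b<c
  ... | tri< a<b _ _ | tri> _ _ c<b | tri< a<c _ _ = a , c , b , Pa , Pc , Pb , a<c , c<b
  ... | tri< a<b _ _ | tri> _ _ c<b | tri> _ _ c<a = c , a , b , Pc , Pa , Pb , c<a , a<b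
  ... | tri> _ _ b<a | tri< b<c _ _ | tri< a<c _ _ = b , a , c , Pb , Pa , Pc , b<a , a<c
  ... | tri> _ _ b<a | tri< b<c _ _ | tri> _ _ c<a = b , c , a , Pb , Pc , Pa , b<c , c<a
  ... | tri> _ _ b<a | tri> _ _ c<b | _            = c , b , a , Pc , Pb , Pa , c<b , b<a

  non-chord-pair⇒codeword : ∀ {a b : Fin k} → a ≢ b → ¬ IsChord k a b → ¬ IsChord k b a → CR k (⁅ a ⁆ ∪ ⁅ b ⁆)
  non-chord-pair⇒codeword {a} {b} a≢b ¬ab ¬ba with ℕ.<-cmp (toℕ a) (toℕ b)
  ... | tri< a<b _ _ = edge⇒codeword (not-chord⇒edge a<b ¬ba)
  ... | tri> _ _ b<a = subst (CR k) (∪-comm ⁅ b ⁆ ⁅ a ⁆) (edge⇒codeword (not-chord⇒edge b<a ¬ab))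
  ... | tri≈ _ a≡b _ = contradiction (toℕ-injective a≡b) a≢b

  -- A chord-free set is a clique of the k-cycle, which has no triangles when k ≥ 4.
  chord-free⇒codeword : 4 ≤ k → ∀ (σ : Subset k) → (∀ {i j} → i ∈ σ → j ∈ σ → ¬ IsChord k i j) →
    (∀ l → l ∉ σ) ⊎ CR k σ
  chord-free⇒codeword 4≤k σ chord-free with any? (_∈? σ)
  ... | no none = inj₁ (λ l l∈σ → none (l , l∈σ))
  ... | yes (a , a∈σ) with any? (λ b → ¬? (b Fin.≟ a) ×-dec (b ∈? σ))
  ...   | no only-a = inj₂ (inj₁ (a , ⊆-antisym σ⊆⁅a⁆ (λ x∈⁅a⁆ → subst (_∈ σ) (sym (x∈⁅y⁆⇒x≡y a x∈⁅a⁆)) a∈σ)))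
    where
    σ⊆⁅a⁆ : σ ⊆ ⁅ a ⁆
    σ⊆⁅a⁆ {x} x∈σ with x Fin.≟ a
    ... | yes refl = x∈⁅x⁆ a
    ... | no  x≢a  = contradiction (x , x≢a , x∈σ) only-a
  ...   | yes (b , b≢a , b∈σ) with any? (λ l → ¬? (l Fin.≟ a) ×-dec (¬? (l Fin.≟ b) ×-dec (l ∈? σ)))
  ...     | yes (l , l≢a , l≢b , l∈σ)
    with in-order (_∈ σ) a∈σ b∈σ l∈σ (λ a≡b → b≢a (sym a≡b)) (λ a≡l → l≢a (sym a≡l)) (λ b≡l → l≢b (sym b≡l))
  ...       | x , y , z , x∈σ , y∈σ , z∈σ , x<y , y<z = ⊥-elim (
    no-triangle 4≤k x<y y<z (edge x∈σ y∈σ x<y) (edge y∈σ z∈σ y<z) (edge x∈σ z∈σ (ℕ.<-trans x<y y<z)))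
    where
    edge : ∀ {u v} → u ∈ σ → v ∈ σ → toℕ u < toℕ v → CycleEdge k (toℕ u) (toℕ v)
    edge u∈σ v∈σ u<v = not-chord⇒edge u<v (chord-free v∈σ u∈σ)
  chord-free⇒codeword 4≤k σ chord-free | yes (a , a∈σ) | yes (b , b≢a , b∈σ) | no only-a-b =
    inj₂ (subst (CR k) (sym (⊆-antisym σ⊆ab (pair⊆ a∈σ b∈σ)))
                (non-chord-pair⇒codeword (λ a≡b → b≢a (sym a≡b)) (chord-free a∈σ b∈σ) (chord-free b∈σ a∈σ)))
    where
    σ⊆ab : σ ⊆ ⁅ a ⁆ ∪ ⁅ b ⁆
    σ⊆ab {x} x∈σ with x Fin.≟ a | x Fin.≟ b
    ... | yes refl | _        = i∈pair a b
    ... | no  _    | yes refl = j∈pair a b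
    ... | no  x≢a  | no  x≢b  = contradiction (x , x≢a , x≢b , x∈σ) only-a-b

module _ {k : ℕ} where

  singletons∈CR : ∀ a → CR k ⁅ a ⁆
  singletons∈CR a = inj₁ (a , refl)

  allOff∈J : neuralIdeal (CR k) allOff
  allOff∈J = subst (neuralIdeal (CR k)) pm-⊥-⊤ (pm∈neuralIdeal (CR k) (⊥-Disjoint ⊤) no-codeword)
    where
    no-codeword : ∀ c → CR k c → ¬ (⊥ ⊆ c × ⊤ ⊆ ∁ c)
    no-codeword c c∈C (_ , ⊤⊆∁c) with codeword-nonempty c∈C
    ... | a , a∈c = x∈∁p⇒x∉p (⊤⊆∁c ∈⊤) a∈c

  X*X∈J : ∀ {i j : Fin k} → IsChord k i j → neuralIdeal (CR k) (X i *ₚ X j)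
  X*X∈J {i} {j} chord = neuralIdeal-resp-≈ {f = X i *ₚ X j} {g = pm (⁅ i ⁆ ∪ ⁅ j ⁆) ⊥}
                          (X*X≈pm (chord⇒≢ chord)) (pm∈neuralIdeal (CR k) (Disjoint-⊥ _) no-codeword)
    where
    no-codeword : ∀ c → CR k c → ¬ (⁅ i ⁆ ∪ ⁅ j ⁆ ⊆ c × ⊥ ⊆ ∁ c)
    no-codeword c c∈C (pair⊆c , _) = chord-not-in-codeword chord c∈C (pair⊆c (i∈pair i j)) (pair⊆c (j∈pair i j))

  X*X-pseudoMonomial : ∀ {i j : Fin k} → i ≢ j → IsPseudoMonomial (X i *ₚ X j)
  X*X-pseudoMonomial {i} {j} i≢j = ⁅ i ⁆ ∪ ⁅ j ⁆ , ⊥ , Disjoint-⊥ _ , X*X≈pm i≢j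

  allOff∈CF : ∀ {f} → f ≈ₚ allOff → CF (neuralIdeal (CR k)) f
  allOff∈CF {f} f≈allOff =
      (⊥ , ⊤ , ⊥-Disjoint ⊤ , subst (f ≈ₚ_) (sym pm-⊥-⊤) f≈allOff)
    , neuralIdeal-resp-≈ {f = f} {g = allOff} f≈allOff allOff∈J
    , minimal-if-divisors-≈ (neuralIdeal (CR k)) {f} (λ {g} {h} {σ} {τ} → divisor≈f {g} {h} {σ} {τ})
    where
    f[∅] : eval ⊥ f ≡ true
    f[∅] = trans (eval-resp-≈ ⊥ {f} {allOff} f≈allOff)
                 (subst (λ p → eval ⊥ p ≡ true) (pm-⊥-⊤ {k})
                        (trans (eval-pm {k} ⊥ ⊥ ⊤) (fits⁺ {k} {⊥} {⊤} {⊥} (λ x∈⊥ → x∈⊥) (λ _ → x∉p⇒x∈∁p ∉⊥))))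
    divisor≈f : ∀ {g h σ τ} → Disjoint σ τ → g ≈ₚ pm σ τ → neuralIdeal (CR k) g → f ≈ₚ h *ₚ g → g ≈ₚ f
    divisor≈f {g} {h} {σ} {τ} σ∩τ=∅ g≈pm g∈J f≈hg =
      ≈-trans {p = g} {q = allOff} {r = f}
        (empty-σ⇒≈allOff (CR k) singletons∈CR {g = g} {σ = σ} {τ = τ} g≈pm g∈J σ-empty) (≈-sym {p = f} {q = allOff} f≈allOff)
      where
      σ-empty : ∀ l → l ∉ σ
      σ-empty l l∈σ = ∉⊥ (proj₁ (divisor-fits {f = f} {h} {g} {σ} {τ} ⊥ σ∩τ=∅ g≈pm f≈hg f[∅]) l∈σ)

  chord∈CF : ∀ {f} {i j : Fin k} → IsChord k i j → f ≈ₚ X i *ₚ X j → CF (neuralIdeal (CR k)) f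
  chord∈CF {f} {i} {j} chord f≈XX =
      (⁅ i ⁆ ∪ ⁅ j ⁆ , ⊥ , Disjoint-⊥ _ , ≈-trans {p = f} {q = X i *ₚ X j} {r = pm (⁅ i ⁆ ∪ ⁅ j ⁆) ⊥} f≈XX (X*X≈pm i≢j))
    , neuralIdeal-resp-≈ {f = f} {g = X i *ₚ X j} f≈XX (X*X∈J chord)
    , minimal-if-divisors-≈ (neuralIdeal (CR k)) {f} (λ {g} {h} {σ} {τ} → divisor≈f {g} {h} {σ} {τ})
    where
    i≢j = chord⇒≢ chord
    f-on-pair : ∀ c → i ∈ c → j ∈ c → eval c f ≡ true
    f-on-pair c i∈c j∈c = trans (eval-resp-≈ c {f} {X i *ₚ X j} f≈XX)
                                (trans (eval-X*X c i j) (cong₂ _∧_ (∈⇒lookup i∈c) (∈⇒lookup j∈c)))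
    divisor≈f : ∀ {g h σ τ} → Disjoint σ τ → g ≈ₚ pm σ τ → neuralIdeal (CR k) g → f ≈ₚ h *ₚ g → g ≈ₚ f
    divisor≈f {g} {h} {σ} {τ} σ∩τ=∅ g≈pm g∈J f≈hg =
      ≈-trans {p = g} {q = pm (⁅ i ⁆ ∪ ⁅ j ⁆) ⊥} {r = f} (subst (g ≈ₚ_) (cong₂ pm σ≡pair τ≡⊥) g≈pm)
        (≈-trans {p = pm (⁅ i ⁆ ∪ ⁅ j ⁆) ⊥} {q = X i *ₚ X j} {r = f}
          (≈-sym {p = X i *ₚ X j} {q = pm (⁅ i ⁆ ∪ ⁅ j ⁆) ⊥} (X*X≈pm i≢j)) (≈-sym {p = f} {q = X i *ₚ X j} f≈XX))
      where
      fits-at : ∀ c → i ∈ c → j ∈ c → σ ⊆ c × τ ⊆ ∁ c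
      fits-at c i∈c j∈c = divisor-fits {f = f} {h} {g} {σ} {τ} c σ∩τ=∅ g≈pm f≈hg (f-on-pair c i∈c j∈c)
      σ⊆pair : σ ⊆ ⁅ i ⁆ ∪ ⁅ j ⁆
      σ⊆pair = proj₁ (fits-at _ (i∈pair i j) (j∈pair i j))
      τ-empty : ∀ l → l ∉ τ
      τ-empty l l∈τ = x∈∁p⇒x∉p (proj₂ (fits-at ⊤ ∈⊤ ∈⊤) l∈τ) ∈⊤
      -- If a ∉ σ then σ ⊆ {b}, and g would not vanish on the codeword {b}.
      first∈σ : ∀ {a b} → σ ⊆ ⁅ a ⁆ ∪ ⁅ b ⁆ → a ∈ σ
      first∈σ {a} {b} σ⊆ab with a ∈? σ
      ... | yes a∈σ = a∈σ
      ... | no  a∉σ = ⊥-elim (∈neuralIdeal⇒no-codeword (CR k) {g = g} g≈pm g∈J ⁅ b ⁆ (singletons∈CR b)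
                                (σ⊆⁅b⁆ , λ {l} l∈τ → ⊥-elim (τ-empty l l∈τ)))
        where
        σ⊆⁅b⁆ : σ ⊆ ⁅ b ⁆
        σ⊆⁅b⁆ {x} x∈σ with pair-member (σ⊆ab x∈σ)
        ... | inj₁ refl = ⊥-elim (a∉σ x∈σ)
        ... | inj₂ refl = x∈⁅x⁆ x
      σ≡pair : σ ≡ ⁅ i ⁆ ∪ ⁅ j ⁆
      σ≡pair = ⊆-antisym σ⊆pair
                 (pair⊆ (first∈σ σ⊆pair) (first∈σ (λ x∈σ → subst (_ ∈_) (∪-comm ⁅ i ⁆ ⁅ j ⁆) (σ⊆pair x∈σ))))
      τ≡⊥ : τ ≡ ⊥
      τ≡⊥ = Empty-unique (λ { (l , l∈τ) → τ-empty l l∈τ })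

  AllOffOrChord : Poly k → Set
  AllOffOrChord f = f ≈ₚ allOff ⊎ ∃[ i ] ∃[ j ] (toℕ j < toℕ i × toℕ i ∸ toℕ j ≢ 1 × toℕ i ∸ toℕ j ≢ k ∸ 1 × f ≈ₚ X i *ₚ X j)

  allOff-or-chord⇒CF : ∀ {f} → AllOffOrChord f → CF (neuralIdeal (CR k)) f
  allOff-or-chord⇒CF {f} (inj₁ f≈allOff)                              = allOff∈CF {f} f≈allOff
  allOff-or-chord⇒CF {f} (inj₂ (i , j , j<i , i-j≢1 , i-j≢k-1 , f≈X*X)) = chord∈CF {f} (j<i , i-j≢1 , i-j≢k-1) f≈X*X

  -- Minimality forbids any further variable next to the divisor  x_i x_j ∈ J.
  minimal-with-chord⇒≈X*X : ∀ {f σ τ} {i j : Fin k} → Disjoint σ τ → f ≈ₚ pm σ τ → IsMinimalPM (neuralIdeal (CR k)) f →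
    i ∈ σ → j ∈ σ → IsChord k i j → f ≈ₚ X i *ₚ X j
  minimal-with-chord⇒≈X*X {f} {σ} {τ} {i} {j} σ∩τ=∅ f≈pm f-minimal i∈σ j∈σ chord
    with any? (λ l → ¬? (l Fin.≟ i) ×-dec (¬? (l Fin.≟ j) ×-dec (l ∈? σ ∪ τ)))
  ... | yes (l , l≢i , l≢j , l∈σ∪τ) =
    ⊥-elim (f-minimal (X i *ₚ X j , X*X-pseudoMonomial i≢j , X*X∈J chord , deg-X*X<deg-f , pm (σ - i - j) τ , f≈pm*X*X))
    where
    i≢j = chord⇒≢ chord
    -- deg (x_i x_j) ≤ 2 < 3 ≤ ∣σ ∪ τ∣ ≤ deg f
    deg-X*X<deg-f : deg (X i *ₚ X j) < deg f
    deg-X*X<deg-f = ℕ.≤-trans (s≤s (deg-X*X≤2 i j))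
      (ℕ.≤-trans (3≤∣S∣ (x∈p∪q⁺ (inj₁ i∈σ)) (x∈p∪q⁺ (inj₁ j∈σ)) l∈σ∪τ i≢j (λ i≡l → l≢i (sym i≡l)) (λ j≡l → l≢j (sym j≡l)))
        (subst (∣ σ ∪ τ ∣ ≤_) (sym (deg-resp-≈ {p = f} {q = pm σ τ} f≈pm)) (∣σ∪τ∣≤deg-pm σ∩τ=∅)))
    f≈pm*X*X : f ≈ₚ pm (σ - i - j) τ *ₚ (X i *ₚ X j)
    f≈pm*X*X = ≈-trans {p = f} {q = pm σ τ} {r = pm (σ - i - j) τ *ₚ (X i *ₚ X j)} f≈pm (pm≈pm*X*X σ∩τ=∅ i∈σ j∈σ i≢j)
  ... | no only-i-j = f≈X*X
    where
    σ∪τ⊆pair : ∀ {x} → x ∈ σ ∪ τ → x ∈ ⁅ i ⁆ ∪ ⁅ j ⁆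
    σ∪τ⊆pair {x} x∈σ∪τ with x Fin.≟ i | x Fin.≟ j
    ... | yes refl | _        = i∈pair i j
    ... | no  _    | yes refl = j∈pair i j
    ... | no  x≢i  | no  x≢j  = contradiction (x , x≢i , x≢j , x∈σ∪τ) only-i-j
    τ-empty : ∀ l → l ∉ τ
    τ-empty l l∈τ with pair-member (σ∪τ⊆pair (x∈p∪q⁺ (inj₂ l∈τ)))
    ... | inj₁ refl = σ∩τ=∅ l (i∈σ , l∈τ)
    ... | inj₂ refl = σ∩τ=∅ l (j∈σ , l∈τ)
    σ≡pair : σ ≡ ⁅ i ⁆ ∪ ⁅ j ⁆
    σ≡pair = ⊆-antisym (λ x∈σ → σ∪τ⊆pair (x∈p∪q⁺ (inj₁ x∈σ))) (pair⊆ i∈σ j∈σ)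
    τ≡⊥ : τ ≡ ⊥
    τ≡⊥ = Empty-unique (λ { (l , l∈τ) → τ-empty l l∈τ })
    f≈X*X : f ≈ₚ X i *ₚ X j
    f≈X*X = ≈-trans {p = f} {q = pm (⁅ i ⁆ ∪ ⁅ j ⁆) ⊥} {r = X i *ₚ X j} (subst (f ≈ₚ_) (cong₂ pm σ≡pair τ≡⊥) f≈pm)
              (≈-sym {p = X i *ₚ X j} {q = pm (⁅ i ⁆ ∪ ⁅ j ⁆) ⊥} (X*X≈pm (chord⇒≢ chord)))

  CF⇒allOff-or-chord : 4 ≤ k → ∀ {f} → CF (neuralIdeal (CR k)) f → AllOffOrChord f
  CF⇒allOff-or-chord 4≤k {f} ((σ , τ , σ∩τ=∅ , f≈pm) , f∈J , f-minimal)
    with any? (λ i → any? (λ j → (i ∈? σ) ×-dec ((j ∈? σ) ×-dec isChord? k i j)))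
  ... | yes (i , j , i∈σ , j∈σ , chord@(j<i , i-j≢1 , i-j≢k-1)) =
    inj₂ (i , j , j<i , i-j≢1 , i-j≢k-1 , minimal-with-chord⇒≈X*X {f} {σ} {τ} σ∩τ=∅ f≈pm f-minimal i∈σ j∈σ chord)
  ... | no no-chord with chord-free⇒codeword 4≤k σ (λ i∈σ j∈σ chord → no-chord (_ , _ , i∈σ , j∈σ , chord))
  ...   | inj₁ σ-empty = inj₁ (empty-σ⇒≈allOff (CR k) singletons∈CR {g = f} {σ = σ} {τ = τ} f≈pm f∈J σ-empty)
  ...   | inj₂ σ∈C     = ⊥-elim (∈neuralIdeal⇒no-codeword (CR k) {g = f} f≈pm f∈J σ σ∈C ((λ x∈σ → x∈σ) , τ⊆∁σ))
    where
    τ⊆∁σ : τ ⊆ ∁ σ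
    τ⊆∁σ {x} x∈τ = x∉p⇒x∈∁p (λ x∈σ → σ∩τ=∅ x (x∈σ , x∈τ))

mainTheorem16 : (k : ℕ) → 4 ≤ k → (f : Poly k) →
    CF (neuralIdeal (CR k)) f
      ⇔ (f ≈ₚ prodₚ (map 1-X (allFin k))
         ⊎ ∃[ i ] ∃[ j ] (toℕ j < toℕ i × toℕ i ∸ toℕ j ≢ 1 × toℕ i ∸ toℕ j ≢ k ∸ 1
                          × f ≈ₚ X i *ₚ X j))
mainTheorem16 k 4≤k f = mk⇔ (CF⇒allOff-or-chord 4≤k {f}) (allOff-or-chord⇒CF {k} {f})
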